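{- Let $\mathsf{M}$ be a sparse paving matroid of rank $k\geq1$ and cardinality $n$, having exactly $\lambda$ circuit-hyperplanes. Then \[P_{\mathsf{M}}(t)=P_{\mathsf{U}_{k,n}}(t)-\lambda p_k(t),\qquad Q_{\mathsf{M}}(t)=Q_{\mathsf{U}_{k,n}}(t)-\lambda q_k(t),\qquad Z_{\mathsf{M}}(t)=Z_{\mathsf{U}_{k,n}}(t)-\lambda z_k(t).\]
   Context: A matroid of rank $k$ is paving if all its circuits have size at least $k$, and sparse paving if moreover all its hyperplanes have size at most $k$. $\mathsf{U}_{k,n}$ is the uniform matroid of rank $k$ on $n$ elements. A circuit-hyperplane is a subset that is both a circuit and a hyperplane; the relaxation of a matroid by a circuit-hyperplane $H$ is the matroid on the same ground set whose bases are the original bases together with $H$. For a matroid $\mathsf{M}$ on $E$ with rank function $\operatorname{rk}$, $\mathscr{L}(\mathsf{M})$ is its set of flats; for a flat $F$, $\mathsf{M}^F$ is the restriction to $F$ and $\mathsf{M}_F$ the contraction by $F$ (ground set $E\smallsetminus F$, rank $A\mapsto\operatorname{rk}(A\cup F)-\operatorname{rk}(F)$); $\chi_{\mathsf{M}}(t)=\sum_{A\subseteq E}(-1)^{|A|}t^{\operatorname{rk}(\mathsf{M})-\operatorname{rk}(A)}$. $P_{\mathsf{M}}\in\mathbb{Z}[t]$ (Kazhdan--Lusztig polynomial) is uniquely determined by: (1) if $\operatorname{rk}(\mathsf{M})=0$, $P_{\mathsf{M}}=1$ if $E=\varnothing$ and $0$ otherwise; (2) if $\operatorname{rk}(\mathsf{M})>0$,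 $\deg P_{\mathsf{M}}<\operatorname{rk}(\mathsf{M})/2$; (3) $t^{\operatorname{rk}(\mathsf{M})}P_{\mathsf{M}}(t^{ -1})=\sum_{F\in\mathscr{L}(\mathsf{M})}\chi_{\mathsf{M}^F}(t)P_{\mathsf{M}_F}(t)$. $Q_{\mathsf{M}}$ (inverse Kazhdan--Lusztig polynomial) is uniquely determined by (1),(2) with $Q$ in place of $P$ and (3') $(-t)^{\operatorname{rk}(\mathsf{M})}Q_{\mathsf{M}}(t^{ -1})=\sum_{F\in\mathscr{L}(\mathsf{M})}(-1)^{\operatorname{rk}(F)}Q_{\mathsf{M}^F}(t)t^{\operatorname{rk}(\mathsf{M})-\operatorname{rk}(F)}\chi_{\mathsf{M}_F}(t^{ -1})$. $Z_{\mathsf{M}}(t)=\sum_{F\in\mathscr{L}(\mathsf{M})}t^{\operatorname{rk}(F)}P_{\mathsf{M}_F}(t)$. For $k\ge1$, $p_k,q_k,z_k\in\mathbb{Z}[t]$ are the (uniquely determined) polynomials such that for every matroid $\mathsf{N}$ of rank $k$ with a circuit-hyperplane and $\widetilde{\mathsf{N}}$ its relaxation, $P_{\widetilde{\mathsf{N}}}=P_{\mathsf{N}}+p_k$, $Q_{\widetilde{\mathsf{N}}}=Q_{\mathsf{N}}+q_k$, $Z_{\widetilde{\mathsf{N}}}=Z_{\mathsf{N}}+z_k$. -}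

module Defs where

open import Data.Bool using (Bool; true; false; _∧_; _∨_; not; if_then_else_; T)
open import Data.Nat as ℕ using (ℕ; zero; suc; _≤_; _<_; _∸_; _⊓_; _⊔_; _≤ᵇ_; _<ᵇ_; _≡ᵇ_)
import Data.Nat as N
open import Data.Integer as ℤ using (ℤ; +_; -_)
open import Data.Fin using (Fin)
open import Data.Fin.Subset using (Subset; ⊥; ⊤; ⁅_⁆; _⊆_; _∩_; _∪_; ∁; _─_; ∣_∣)
open import Data.Vec using (Vec; []; _∷_; lookup; zipWith; foldr)
open import Data.List as L using (List; []; _∷_; _++_; map; filterᵇ; length; upTo; allFin)
open import Data.Product using (_×_)
open import Relation.Binary.PropositionalEquality using (_≡_; _≢_)

-- Polynomials in ℤ[t], represented by their coefficient sequences.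
-- (p i) is the coefficient of t^i.  Equality is coefficientwise.

Poly : Set
Poly = ℕ → ℤ

_≈ₚ_ : Poly → Poly → Set
p ≈ₚ q = ∀ i → p i ≡ q i

infix 4 _≈ₚ_
infixl 6 _+ₚ_ _-ₚ_
infixl 7 _*ₚ_ _·ₚ_

0ₚ : Poly
0ₚ _ = + 0

mono : ℕ → Poly
mono d i = if i ≡ᵇ d then + 1 else + 0

1ₚ : Poly
1ₚ = mono 0

_+ₚ_ : Poly → Poly → Poly
(p +ₚ q) i = p i ℤ.+ q i

_·ₚ_ : ℤ → Poly → Poly
(c ·ₚ p) i = c ℤ.* p i

_-ₚ_ : Poly → Poly → Poly
(p -ₚ q) i = p i ℤ.- q i

sumℤ : List ℤ → ℤ
sumℤ = L.foldr ℤ._+_ (+ 0)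

_*ₚ_ : Poly → Poly → Poly
(p *ₚ q) i = sumℤ (map (λ j → p j ℤ.* q (i ∸ j)) (upTo (suc i)))

sumₚ : List Poly → Poly
sumₚ = L.foldr _+ₚ_ 0ₚ

-- rev d p  represents  t^d p(t^{-1})  (valid whenever deg p ≤ d)
rev : ℕ → Poly → Poly
rev d p i = if i ≤ᵇ d then p (d ∸ i) else + 0

sign : ℕ → ℤ
sign zero = + 1
sign (suc m) = - sign m

DegLtHalf : ℕ → Poly → Set
DegLtHalf r p = ∀ i → r ≤ 2 N.* i → p i ≡ + 0

allSubsets : ∀ n → List (Subset n)
allSubsets zero = [] ∷ []
allSubsets (suc n) = map (false ∷_) (allSubsets n) ++ map (true ∷_) (allSubsets n)

_∈ᵇ_ : ∀ {n} → Fin n → Subset n → Bool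
x ∈ᵇ A = lookup A x

_⊆ᵇ_ : ∀ {n} → Subset n → Subset n → Bool
A ⊆ᵇ B = foldr _ _∧_ true (zipWith (λ a b → not a ∨ b) A B)

_==ᵇ_ : ∀ {n} → Subset n → Subset n → Bool
A ==ᵇ B = (A ⊆ᵇ B) ∧ (B ⊆ᵇ A)

subsetsOf : ∀ {n} → Subset n → List (Subset n)
subsetsOf {n} E = filterᵇ (λ A → A ⊆ᵇ E) (allSubsets n)

allᵇ : ∀ {A : Set} → (A → Bool) → List A → Bool
allᵇ p = L.foldr (λ x b → p x ∧ b) true

maxℕ : List ℕ → ℕ
maxℕ = L.foldr _⊔_ 0

-- Matroids on a ground set E ⊆ Fin n, given by a rank function.
-- (Only the values of rk on subsets of E are meaningful.)

record RawMatroid (n : ℕ) : Set where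
  field
    ground : Subset n
    rk     : Subset n → ℕ
open RawMatroid public

IsMatroid : ∀ {n} → RawMatroid n → Set
IsMatroid M =
  (∀ A → A ⊆ ground M → rk M A ≤ ∣ A ∣) ×
  (∀ A B → B ⊆ ground M → A ⊆ B → rk M A ≤ rk M B) ×
  (∀ A B → A ⊆ ground M → B ⊆ ground M →
     rk M (A ∪ B) N.+ rk M (A ∩ B) ≤ rk M A N.+ rk M B)

rank : ∀ {n} → RawMatroid n → ℕ
rank M = rk M (ground M)

isIndepᵇ : ∀ {n} → RawMatroid n → Subset n → Bool
isIndepᵇ M A = (A ⊆ᵇ ground M) ∧ (rk M A ≡ᵇ ∣ A ∣)

isFlatᵇ : ∀ {n} → RawMatroid n → Subset n → Bool
isFlatᵇ {n} M F =
  (F ⊆ᵇ ground M) ∧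
  allᵇ (λ x → not ((x ∈ᵇ ground M) ∧ not (x ∈ᵇ F)) ∨ (rk M F <ᵇ rk M (F ∪ ⁅ x ⁆)))
      (allFin n)

flats : ∀ {n} → RawMatroid n → List (Subset n)
flats M = filterᵇ (isFlatᵇ M) (subsetsOf (ground M))

isCircuitᵇ : ∀ {n} → RawMatroid n → Subset n → Bool
isCircuitᵇ M C =
  (C ⊆ᵇ ground M) ∧ not (isIndepᵇ M C) ∧
  allᵇ (λ B → (B ==ᵇ C) ∨ isIndepᵇ M B) (subsetsOf C)

isHyperplaneᵇ : ∀ {n} → RawMatroid n → Subset n → Bool
isHyperplaneᵇ M H = isFlatᵇ M H ∧ (suc (rk M H) ≡ᵇ rank M)

isCircuitHyperplaneᵇ : ∀ {n} → RawMatroid n → Subset n → Bool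
isCircuitHyperplaneᵇ M H = isCircuitᵇ M H ∧ isHyperplaneᵇ M H

numCircuitHyperplanes : ∀ {n} → RawMatroid n → ℕ
numCircuitHyperplanes M = length (filterᵇ (isCircuitHyperplaneᵇ M) (subsetsOf (ground M)))

IsPaving : ∀ {n} → RawMatroid n → Set
IsPaving M = ∀ C → T (isCircuitᵇ M C) → rank M ≤ ∣ C ∣

IsSparsePaving : ∀ {n} → RawMatroid n → Set
IsSparsePaving M = IsPaving M × (∀ H → T (isHyperplaneᵇ M H) → ∣ H ∣ ≤ rank M)

isBasisᵇ : ∀ {n} → RawMatroid n → Subset n → Bool
isBasisᵇ M B = isIndepᵇ M B ∧ (rk M B ≡ᵇ rank M)

-- relaxation: bases are the old bases together with H;
-- rank of A is max over bases B of |A ∩ B|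
relax : ∀ {n} → RawMatroid n → Subset n → RawMatroid n
relax M H = record
  { ground = ground M
  ; rk = λ A → maxℕ (map (λ B → ∣ A ∩ B ∣)
                       (filterᵇ (λ B → isBasisᵇ M B ∨ (B ==ᵇ H)) (subsetsOf (ground M))))
  }

restrict : ∀ {n} → RawMatroid n → Subset n → RawMatroid n
restrict M F = record { ground = F ; rk = rk M }

contract : ∀ {n} → RawMatroid n → Subset n → RawMatroid n
contract M F = record { ground = ground M ─ F ; rk = λ A → rk M (A ∪ F) ∸ rk M F }

uniform : (k n : ℕ) → RawMatroid n
uniform k n = record { ground = ⊤ ; rk = λ A → k ⊓ ∣ A ∣ }

χ : ∀ {n} → RawMatroid n → Poly
χ M = sumₚ (map (λ A → sign ∣ A ∣ ·ₚ mono (rank M ∸ rk M A)) (subsetsOf (ground M)))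

Family : Set
Family = ∀ {n} → RawMatroid n → Poly

IsKL : Family → Set
IsKL P = ∀ {n} (M : RawMatroid n) → IsMatroid M →
  (rank M ≡ 0 → (ground M ≡ ⊥ → P M ≈ₚ 1ₚ) × (ground M ≢ ⊥ → P M ≈ₚ 0ₚ)) ×
  (0 < rank M → DegLtHalf (rank M) (P M)) ×
  (rev (rank M) (P M) ≈ₚ
     sumₚ (map (λ F → χ (restrict M F) *ₚ P (contract M F)) (flats M)))

IsInvKL : Family → Set
IsInvKL Q = ∀ {n} (M : RawMatroid n) → IsMatroid M →
  (rank M ≡ 0 → (ground M ≡ ⊥ → Q M ≈ₚ 1ₚ) × (ground M ≢ ⊥ → Q M ≈ₚ 0ₚ)) ×
  (0 < rank M → DegLtHalf (rank M) (Q M)) ×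
  (sign (rank M) ·ₚ rev (rank M) (Q M) ≈ₚ
     sumₚ (map (λ F → sign (rk M F) ·ₚ
                   (Q (restrict M F) *ₚ rev (rank M ∸ rk M F) (χ (contract M F))))
               (flats M)))

Zpoly : Family → Family
Zpoly P M = sumₚ (map (λ F → mono (rk M F) *ₚ P (contract M F)) (flats M))

-- p is "the" polynomial p_k (resp. q_k, z_k) for the family P:
-- relaxing a circuit-hyperplane of any rank-k matroid adds p.
RelaxationDifference : Family → ℕ → Poly → Set
RelaxationDifference P k p =
  ∀ {m} (N : RawMatroid m) → IsMatroid N → rank N ≡ k →
  ∀ H → T (isCircuitHyperplaneᵇ N H) → P (relax N H) ≈ₚ P N +ₚ p

-- Two matroids on the same ground set whose rank functions agree there have the same P, Q
-- and Z. This goes by induction on the rank: coefficients of degree ≥ rank/2 vanish, and the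
-- coefficient of degree i < rank/2 is read off the defining identity in degree rank − i, a sum
-- over the same flats for both matroids whose terms either involve a restriction or contraction
-- of smaller rank or vanish for the same degree reason.
--
-- By the paving axioms, a sparse paving matroid of rank r + 1 on Fin n is determined by the list
-- S of its circuit-hyperplanes: its rank function is min(r + 1, |A|), lowered to r on S.
-- Conversely, any list S of (r + 1)-sets pairwise sharing fewer than r elements defines such a
-- matroid N_S, every member of S is a circuit-hyperplane of it, and relaxing H in N_(H ∷ S)
-- gives N_S. Peeling the circuit-hyperplanes off one at a time, from N_S = M down to
-- N_[] = U_(r+1,n), changes P, Q and Z by p, q and z at each step.

module Submission where

open import Defs
open import Data.Bool using (Bool; true; false; _∧_; _∨_; not; T)
open import Data.Bool.Properties using (T-∧; T-∨; T?)
open import Data.Nat as ℕ using (ℕ; zero; suc; _≤_; _<_; _∸_; _⊓_; _+_; z≤n; s≤s; _<ᵇ_)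
open import Data.Nat.Properties
open import Data.Integer as ℤ using (ℤ; +_)
import Data.Integer.Properties as ℤP
open import Data.Integer.Tactic.RingSolver using (solve-∀)
open import Data.Fin using (Fin; zero; suc)
open import Data.Fin.Properties using (¬∀⟶∃¬)
open import Data.Fin.Subset using (Subset; ⊤; ⊥; ⁅_⁆; _⊆_; _∩_; _∪_; _─_; _-_; ∣_∣; _∈_; _∉_)
open import Data.Fin.Subset.Properties
open import Data.Vec using ([]; _∷_; here; there; lookup)
open import Data.Vec.Properties using (≡-dec; ∷-injectiveʳ; []=⇒lookup; lookup⇒[]=)
open import Data.List using (List; []; _∷_; map; filterᵇ; allFin; upTo; length)
open import Data.List.Properties using (filter-≐; map-cong)
open import Data.List.Membership.Propositional using () renaming (_∈_ to _∈ₗ_; _∉_ to _∉ₗ_)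
open import Data.List.Membership.Propositional.Properties
  using (∈-map⁺; ∈-map⁻; ∈-++⁺ˡ; ∈-++⁺ʳ; ∈-filter⁺; ∈-filter⁻; ∈-allFin; ∈-upTo⁻)
open import Data.List.Relation.Unary.Any using (here; there; any?)
open import Data.List.Relation.Unary.Unique.Propositional using (Unique) renaming (tail to Unique-tail)
open import Data.List.Relation.Unary.AllPairs using ([]; _∷_)
open import Data.List.Relation.Unary.All using ([])
import Data.List.Relation.Unary.Unique.Propositional.Properties as Unique
open import Data.Product using (_×_; _,_; proj₁; proj₂; ∃)
open import Data.Sum using (_⊎_; inj₁; inj₂)
open import Data.Unit using (tt)
open import Function using (_∘_; const; _⇔_; mk⇔; Equivalence)
open import Relation.Nullary using (¬_; Dec; yes; no; contradiction)
open import Relation.Nullary.Decidable using (¬?; _→-dec_)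
open import Relation.Binary using (tri<; tri≈; tri>)
open import Relation.Binary.PropositionalEquality

open Equivalence using (to; from)

private variable
  n : ℕ

_≟ₛ_ : (A B : Subset n) → Dec (A ≡ B)
_≟ₛ_ = ≡-dec Data.Bool._≟_

⊆ᵇ⇔⊆ : (A B : Subset n) → T (A ⊆ᵇ B) ⇔ A ⊆ B
⊆ᵇ⇔⊆ A B = mk⇔ (sound A B) (complete A B)
  where
  sound : ∀ {n} (A B : Subset n) → T (A ⊆ᵇ B) → A ⊆ B
  sound (true ∷ A)  (true ∷ B)  t here      = here
  sound (true ∷ A)  (true ∷ B)  t (there x) = there (sound A B t x)
  sound (false ∷ A) (b ∷ B)     t (there x) = there (sound A B t x)
  complete : ∀ {n} (A B : Subset n) → A ⊆ B → T (A ⊆ᵇ B)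
  complete []          []          _   = tt
  complete (true ∷ A)  (true ∷ B)  A⊆B = complete A B (drop-∷-⊆ A⊆B)
  complete (true ∷ A)  (false ∷ B) A⊆B with () ← A⊆B here
  complete (false ∷ A) (b ∷ B)     A⊆B = complete A B (drop-∷-⊆ A⊆B)

==ᵇ⇒≡ : (A B : Subset n) → T (A ==ᵇ B) → A ≡ B
==ᵇ⇒≡ A B t = ⊆-antisym (to (⊆ᵇ⇔⊆ A B) (proj₁ both)) (to (⊆ᵇ⇔⊆ B A) (proj₂ both))
  where both = to (T-∧ {A ⊆ᵇ B}) t

==ᵇ-refl : (A : Subset n) → T (A ==ᵇ A)
==ᵇ-refl A = from T-∧ (from (⊆ᵇ⇔⊆ A A) ⊆-refl , from (⊆ᵇ⇔⊆ A A) ⊆-refl)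

∈-filterᵇ⁺ : {X : Set} (p : X → Bool) {x : X} {xs : List X} →
  x ∈ₗ xs → T (p x) → x ∈ₗ filterᵇ p xs
∈-filterᵇ⁺ p = ∈-filter⁺ (T? ∘ p)

∈-filterᵇ⁻ : {X : Set} (p : X → Bool) {x : X} {xs : List X} →
  x ∈ₗ filterᵇ p xs → x ∈ₗ xs × T (p x)
∈-filterᵇ⁻ p = ∈-filter⁻ (T? ∘ p)

allᵇ⇔ : {X : Set} (p : X → Bool) (xs : List X) → T (allᵇ p xs) ⇔ (∀ {x} → x ∈ₗ xs → T (p x))
allᵇ⇔ p xs = mk⇔ (elim xs) (intro xs)
  where
  elim : ∀ xs → T (allᵇ p xs) → ∀ {x} → x ∈ₗ xs → T (p x)
  elim (y ∷ ys) t (here refl) = proj₁ (to (T-∧ {p y}) t)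
  elim (y ∷ ys) t (there x∈) = elim ys (proj₂ (to (T-∧ {p y}) t)) x∈
  intro : ∀ xs → (∀ {x} → x ∈ₗ xs → T (p x)) → T (allᵇ p xs)
  intro []       h = tt
  intro (y ∷ ys) h = from T-∧ (h (here refl) , intro ys (h ∘ there))

∈-allSubsets : (A : Subset n) → A ∈ₗ allSubsets n
∈-allSubsets []          = here refl
∈-allSubsets {suc n} (false ∷ A) = ∈-++⁺ˡ (∈-map⁺ (false ∷_) (∈-allSubsets A))
∈-allSubsets {suc n} (true ∷ A)  =
  ∈-++⁺ʳ (map (false ∷_) (allSubsets n)) (∈-map⁺ (true ∷_) (∈-allSubsets A))

allSubsets-unique : ∀ n → Unique (allSubsets n)
allSubsets-unique zero    = [] ∷ []
allSubsets-unique (suc n) =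
  Unique.++⁺ (Unique.map⁺ ∷-injectiveʳ (allSubsets-unique n))
             (Unique.map⁺ ∷-injectiveʳ (allSubsets-unique n)) disjoint
  where
  disjoint : ∀ {A} → ¬ (A ∈ₗ map (false ∷_) (allSubsets n) × A ∈ₗ map (true ∷_) (allSubsets n))
  disjoint (inF , inT) with ∈-map⁻ (false ∷_) inF | ∈-map⁻ (true ∷_) inT
  ... | _ , _ , refl | _ , _ , ()

∈-subsetsOf⁺ : {A E : Subset n} → A ⊆ E → A ∈ₗ subsetsOf E
∈-subsetsOf⁺ {A = A} {E} A⊆E = ∈-filterᵇ⁺ (_⊆ᵇ E) (∈-allSubsets A) (from (⊆ᵇ⇔⊆ A E) A⊆E)

∈-subsetsOf⁻ : {A E : Subset n} → A ∈ₗ subsetsOf E → A ⊆ E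
∈-subsetsOf⁻ {n} {A} {E} A∈ = to (⊆ᵇ⇔⊆ A E) (proj₂ (∈-filterᵇ⁻ (_⊆ᵇ E) {xs = allSubsets n} A∈))

maxℕ-lub : ∀ xs {m} → (∀ {x} → x ∈ₗ xs → x ≤ m) → maxℕ xs ≤ m
maxℕ-lub []       h = z≤n
maxℕ-lub (x ∷ xs) h = ⊔-lub (h (here refl)) (maxℕ-lub xs (h ∘ there))

≤-maxℕ : ∀ {xs x} → x ∈ₗ xs → x ≤ maxℕ xs
≤-maxℕ {y ∷ xs} (here refl) = m≤m⊔n y (maxℕ xs)
≤-maxℕ {y ∷ xs} (there x∈)  = ≤-trans (≤-maxℕ x∈) (m≤n⊔m y (maxℕ xs))

_∈ₛ?_ : (A : Subset n) (S : List (Subset n)) → Dec (A ∈ₗ S)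
A ∈ₛ? S = any? (A ≟ₛ_) S

¬T⇒T-not : ∀ {b} → ¬ T b → T (not b)
¬T⇒T-not {false} _  = tt
¬T⇒T-not {true}  ¬t = ¬t tt

∣p∪⁅x⁆∣≡1+∣p∣ : (p : Subset n) {x : Fin n} → x ∉ p → ∣ p ∪ ⁅ x ⁆ ∣ ≡ suc ∣ p ∣
∣p∪⁅x⁆∣≡1+∣p∣ (true ∷ p)  {zero}  x∉p = contradiction here x∉p
∣p∪⁅x⁆∣≡1+∣p∣ (false ∷ p) {zero}  x∉p = cong (suc ∘ ∣_∣) (∪-identityʳ p)
∣p∪⁅x⁆∣≡1+∣p∣ (true ∷ p)  {suc x} x∉p = cong suc (∣p∪⁅x⁆∣≡1+∣p∣ p (x∉p ∘ there))
∣p∪⁅x⁆∣≡1+∣p∣ (false ∷ p) {suc x} x∉p = ∣p∪⁅x⁆∣≡1+∣p∣ p (x∉p ∘ there)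

1+∣p-x∣≡∣p∣ : (p : Subset n) {x : Fin n} → x ∈ p → suc ∣ p - x ∣ ≡ ∣ p ∣
1+∣p-x∣≡∣p∣ (true ∷ p)  {zero}  here      = cong (suc ∘ ∣_∣) (p─⊥≡p p)
1+∣p-x∣≡∣p∣ (true ∷ p)  {suc x} (there x∈p) = cong suc (1+∣p-x∣≡∣p∣ p x∈p)
1+∣p-x∣≡∣p∣ (false ∷ p) {suc x} (there x∈p) = 1+∣p-x∣≡∣p∣ p x∈p

∣p∪q∣+∣p∩q∣≡∣p∣+∣q∣ : (p q : Subset n) → ∣ p ∪ q ∣ + ∣ p ∩ q ∣ ≡ ∣ p ∣ + ∣ q ∣
∣p∪q∣+∣p∩q∣≡∣p∣+∣q∣ []          []          = refl
∣p∪q∣+∣p∩q∣≡∣p∣+∣q∣ (true ∷ p)  (true ∷ q)  =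
  cong suc (trans (+-suc _ _) (trans (cong suc (∣p∪q∣+∣p∩q∣≡∣p∣+∣q∣ p q)) (sym (+-suc _ _))))
∣p∪q∣+∣p∩q∣≡∣p∣+∣q∣ (true ∷ p)  (false ∷ q) = cong suc (∣p∪q∣+∣p∩q∣≡∣p∣+∣q∣ p q)
∣p∪q∣+∣p∩q∣≡∣p∣+∣q∣ (false ∷ p) (true ∷ q)  =
  trans (cong suc (∣p∪q∣+∣p∩q∣≡∣p∣+∣q∣ p q)) (sym (+-suc _ _))
∣p∪q∣+∣p∩q∣≡∣p∣+∣q∣ (false ∷ p) (false ∷ q) = ∣p∪q∣+∣p∩q∣≡∣p∣+∣q∣ p q

p⊆q∧∣q∣≤∣p∣⇒p≡q : {p q : Subset n} → p ⊆ q → ∣ q ∣ ≤ ∣ p ∣ → p ≡ q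
p⊆q∧∣q∣≤∣p∣⇒p≡q {p = []}        {[]}        _   _ = refl
p⊆q∧∣q∣≤∣p∣⇒p≡q {p = true ∷ p}  {true ∷ q}  p⊆q (s≤s ∣q∣≤∣p∣) =
  cong (true ∷_) (p⊆q∧∣q∣≤∣p∣⇒p≡q (drop-∷-⊆ p⊆q) ∣q∣≤∣p∣)
p⊆q∧∣q∣≤∣p∣⇒p≡q {p = true ∷ p}  {false ∷ q} p⊆q _ with () ← p⊆q here
p⊆q∧∣q∣≤∣p∣⇒p≡q {p = false ∷ p} {true ∷ q}  p⊆q ∣q∣≤∣p∣ =
  contradiction (≤-trans ∣q∣≤∣p∣ (p⊆q⇒∣p∣≤∣q∣ (drop-∷-⊆ p⊆q))) (<⇒≱ ≤-refl)
p⊆q∧∣q∣≤∣p∣⇒p≡q {p = false ∷ p} {false ∷ q} p⊆q ∣q∣≤∣p∣ =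
  cong (false ∷_) (p⊆q∧∣q∣≤∣p∣⇒p≡q (drop-∷-⊆ p⊆q) ∣q∣≤∣p∣)

p⊆q∧p≢q⇒∣p∣<∣q∣ : {p q : Subset n} → p ⊆ q → p ≢ q → ∣ p ∣ < ∣ q ∣
p⊆q∧p≢q⇒∣p∣<∣q∣ p⊆q p≢q = ≰⇒> (p≢q ∘ p⊆q∧∣q∣≤∣p∣⇒p≡q p⊆q)

∣r∣≤∣p∩q∣ : {p q r : Subset n} → r ⊆ p → r ⊆ q → ∣ r ∣ ≤ ∣ p ∩ q ∣
∣r∣≤∣p∩q∣ r⊆p r⊆q = p⊆q⇒∣p∣≤∣q∣ (λ x∈r → x∈p∩q⁺ (r⊆p x∈r , r⊆q x∈r))

∃∈q∖p : {p q : Subset n} → p ⊆ q → ∣ p ∣ < ∣ q ∣ → ∃ λ x → x ∈ q × x ∉ p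
∃∈q∖p {p = true ∷ p}  {true ∷ q}  p⊆q (s≤s ∣p∣<∣q∣) with x , x∈q , x∉p ← ∃∈q∖p (drop-∷-⊆ p⊆q) ∣p∣<∣q∣ =
  suc x , there x∈q , x∉p ∘ drop-there
∃∈q∖p {p = true ∷ p}  {false ∷ q} p⊆q _ with () ← p⊆q here
∃∈q∖p {p = false ∷ p} {true ∷ q}  _ _ = zero , here , λ ()
∃∈q∖p {p = false ∷ p} {false ∷ q} p⊆q ∣p∣<∣q∣ with x , x∈q , x∉p ← ∃∈q∖p (drop-∷-⊆ p⊆q) ∣p∣<∣q∣ =
  suc x , there x∈q , x∉p ∘ drop-there

∃∈p : (p : Subset n) → 0 < ∣ p ∣ → ∃ λ x → x ∈ p
∃∈p {n} p 0<∣p∣ with x , x∈p , _ ← ∃∈q∖p (⊆-min p) (subst (_< ∣ p ∣) (sym (∣⊥∣≡0 n)) 0<∣p∣) = x , x∈p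

∃∉p : (p : Subset n) → ∣ p ∣ < n → ∃ λ x → x ∉ p
∃∉p {n} p ∣p∣<n with x , _ , x∉p ← ∃∈q∖p ⊆⊤ (subst (∣ p ∣ <_) (sym (∣⊤∣≡n n)) ∣p∣<n) = x , x∉p

∃⊆-of-size : (p : Subset n) {m : ℕ} → m ≤ ∣ p ∣ → ∃ λ q → q ⊆ p × ∣ q ∣ ≡ m
∃⊆-of-size {n} p           {zero}  _ = ⊥ , ⊆-min p , ∣⊥∣≡0 n
∃⊆-of-size (true ∷ p)  {suc m} (s≤s m≤∣p∣) with q , q⊆p , ∣q∣≡m ← ∃⊆-of-size p m≤∣p∣ =
  true ∷ q , s⊆s q⊆p , cong suc ∣q∣≡m
∃⊆-of-size (false ∷ p) {suc m} m≤∣p∣ with q , q⊆p , ∣q∣≡m ← ∃⊆-of-size p m≤∣p∣ =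
  false ∷ q , s⊆s q⊆p , ∣q∣≡m

∃⊇-of-size : (p : Subset n) {m : ℕ} → ∣ p ∣ ≤ m → m ≤ n → ∃ λ q → p ⊆ q × ∣ q ∣ ≡ m
∃⊇-of-size []          {zero}  _ _ = [] , ⊆-refl , refl
∃⊇-of-size (true ∷ p)  {suc m} (s≤s ∣p∣≤m) (s≤s m≤n) with q , p⊆q , ∣q∣≡m ← ∃⊇-of-size p ∣p∣≤m m≤n =
  true ∷ q , s⊆s p⊆q , cong suc ∣q∣≡m
∃⊇-of-size {suc n} (false ∷ p) {m} ∣p∣≤m m≤1+n with m ≤? n
... | yes m≤n with q , p⊆q , ∣q∣≡m ← ∃⊇-of-size p ∣p∣≤m m≤n = false ∷ q , s⊆s p⊆q , ∣q∣≡m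
... | no m≰n = ⊤ , ⊆⊤ , trans (∣⊤∣≡n (suc n)) (≤-antisym (≰⇒> m≰n) m≤1+n)

∪-least : {A B C : Subset n} → A ⊆ C → B ⊆ C → A ∪ B ⊆ C
∪-least {A = A} {B} A⊆C B⊆C x∈ with x∈p∪q⁻ A B x∈
... | inj₁ x∈A = A⊆C x∈A
... | inj₂ x∈B = B⊆C x∈B

p─q∪q≡p : {p q : Subset n} → q ⊆ p → (p ─ q) ∪ q ≡ p
p─q∪q≡p {p = p} {q} q⊆p = ⊆-antisym (∪-least (p─q⊆p p q) q⊆p) p⊆
  where
  p⊆ : p ⊆ (p ─ q) ∪ q
  p⊆ {x} x∈p with x ∈? q
  ... | yes x∈q = q⊆p∪q (p ─ q) q x∈q
  ... | no  x∉q = p⊆p∪q q (x∈p∧x∉q⇒x∈p─q x∈p x∉q)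

m+n≤o+p⇒m∸q+n∸q≤o∸q+p∸q : ∀ {m n o p} q → q ≤ m → q ≤ n → q ≤ o → q ≤ p →
  m + n ≤ o + p → (m ∸ q) + (n ∸ q) ≤ (o ∸ q) + (p ∸ q)
m+n≤o+p⇒m∸q+n∸q≤o∸q+p∸q zero _ _ _ _ le = le
m+n≤o+p⇒m∸q+n∸q≤o∸q+p∸q {suc m} {suc n} {suc o} {suc p} (suc q) (s≤s q≤m) (s≤s q≤n) (s≤s q≤o) (s≤s q≤p) (s≤s le) =
  m+n≤o+p⇒m∸q+n∸q≤o∸q+p∸q q q≤m q≤n q≤o q≤p (≤-pred (subst₂ _≤_ (+-suc m n) (+-suc o p) le))

mk : Subset n → (Subset n → ℕ) → RawMatroid n
mk E r = record { ground = E ; rk = r }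

module _ {M : RawMatroid n} (isM : IsMatroid M) where

  rk≤∣∣ : ∀ {A} → A ⊆ ground M → rk M A ≤ ∣ A ∣
  rk≤∣∣ = proj₁ isM _

  rk-mono : ∀ {A B} → B ⊆ ground M → A ⊆ B → rk M A ≤ rk M B
  rk-mono = proj₁ (proj₂ isM) _ _

  rk-submodular : ∀ {A B} → A ⊆ ground M → B ⊆ ground M →
    rk M (A ∪ B) + rk M (A ∩ B) ≤ rk M A + rk M B
  rk-submodular = proj₂ (proj₂ isM) _ _

restrict-isMatroid : {M : RawMatroid n} {F : Subset n} →
  IsMatroid M → F ⊆ ground M → IsMatroid (restrict M F)
restrict-isMatroid isM F⊆E =
  (λ A A⊆F → rk≤∣∣ isM (⊆-trans A⊆F F⊆E)) ,
  (λ A B B⊆F → rk-mono isM (⊆-trans B⊆F F⊆E)) ,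
  (λ A B A⊆F B⊆F → rk-submodular isM (⊆-trans A⊆F F⊆E) (⊆-trans B⊆F F⊆E))

contract-isMatroid : {M : RawMatroid n} {F : Subset n} →
  IsMatroid M → F ⊆ ground M → IsMatroid (contract M F)
contract-isMatroid {n} {M} {F} isM F⊆E = bound , monotone , submodular
  where
  open import Algebra.Properties.IdempotentCommutativeMonoid (∪-idempotentCommutativeMonoid n)
    using (∙-distrʳ-∙)
  E = ground M
  r = rk M
  ∪F⊆E : ∀ {A} → A ⊆ E ─ F → A ∪ F ⊆ E
  ∪F⊆E A⊆ = ∪-least (⊆-trans A⊆ (p─q⊆p E F)) F⊆E
  rF≤ : ∀ {A} → A ⊆ E ─ F → r F ≤ r (A ∪ F)
  rF≤ A⊆ = rk-mono isM (∪F⊆E A⊆) (q⊆p∪q _ F)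
  bound : ∀ A → A ⊆ E ─ F → r (A ∪ F) ∸ r F ≤ ∣ A ∣
  bound A A⊆ = m≤n+o⇒m∸n≤o (r (A ∪ F)) (r F) (begin
    r (A ∪ F)                 ≤⟨ m≤m+n (r (A ∪ F)) (r (A ∩ F)) ⟩
    r (A ∪ F) + r (A ∩ F)     ≤⟨ rk-submodular isM A⊆E F⊆E ⟩
    r A + r F                 ≤⟨ +-monoˡ-≤ (r F) (rk≤∣∣ isM A⊆E) ⟩
    ∣ A ∣ + r F               ≡⟨ +-comm ∣ A ∣ (r F) ⟩
    r F + ∣ A ∣               ∎)
    where
    open ≤-Reasoning
    A⊆E = ⊆-trans A⊆ (p─q⊆p E F)
  monotone : ∀ A B → B ⊆ E ─ F → A ⊆ B → r (A ∪ F) ∸ r F ≤ r (B ∪ F) ∸ r F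
  monotone A B B⊆ A⊆B = ∸-monoˡ-≤ (r F) (rk-mono isM (∪F⊆E B⊆) (∪-least (⊆-trans A⊆B (p⊆p∪q F)) (q⊆p∪q B F)))
  submodular : ∀ A B → A ⊆ E ─ F → B ⊆ E ─ F →
    (r ((A ∪ B) ∪ F) ∸ r F) + (r ((A ∩ B) ∪ F) ∸ r F) ≤ (r (A ∪ F) ∸ r F) + (r (B ∪ F) ∸ r F)
  submodular A B A⊆ B⊆ =
    m+n≤o+p⇒m∸q+n∸q≤o∸q+p∸q (r F) (rF≤ A∪B⊆) (rF≤ A∩B⊆) (rF≤ A⊆) (rF≤ B⊆)
      (subst₂ (λ X Y → r X + r Y ≤ r (A ∪ F) + r (B ∪ F))
        (sym (∙-distrʳ-∙ F A B)) (sym (∪-distribʳ-∩ F A B))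
        (rk-submodular isM (∪F⊆E A⊆) (∪F⊆E B⊆)))
    where
    A∪B⊆ = ∪-least A⊆ B⊆
    A∩B⊆ = ⊆-trans (p∩q⊆p A B) A⊆

Agree : Subset n → (Subset n → ℕ) → (Subset n → ℕ) → Set
Agree E r r' = ∀ {A} → A ⊆ E → r A ≡ r' A

Agree-sym : {E : Subset n} {r r' : Subset n → ℕ} → Agree E r r' → Agree E r' r
Agree-sym agree A⊆E = sym (agree A⊆E)

Agree-isMatroid : {E : Subset n} {r r' : Subset n → ℕ} →
  Agree E r r' → IsMatroid (mk E r) → IsMatroid (mk E r')
Agree-isMatroid agree isM =
  (λ A A⊆E → subst (_≤ ∣ A ∣) (agree A⊆E) (rk≤∣∣ isM A⊆E)) ,
  (λ A B B⊆E A⊆B → subst₂ _≤_ (agree (⊆-trans A⊆B B⊆E)) (agree B⊆E) (rk-mono isM B⊆E A⊆B)) ,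
  (λ A B A⊆E B⊆E → subst₂ _≤_
    (cong₂ _+_ (agree (∪-least A⊆E B⊆E)) (agree (⊆-trans (p∩q⊆p A B) A⊆E)))
    (cong₂ _+_ (agree A⊆E) (agree B⊆E))
    (rk-submodular isM A⊆E B⊆E))

Agree-restrict : {E F : Subset n} {r r' : Subset n → ℕ} → Agree E r r' → F ⊆ E → Agree F r r'
Agree-restrict agree F⊆E A⊆F = agree (⊆-trans A⊆F F⊆E)

Agree-contract : {E F : Subset n} {r r' : Subset n → ℕ} → Agree E r r' → F ⊆ E →
  Agree (E ─ F) (rk (contract (mk E r) F)) (rk (contract (mk E r') F))
Agree-contract {E = E} {F} agree F⊆E A⊆ =
  cong₂ _∸_ (agree (∪-least (⊆-trans A⊆ (p─q⊆p E F)) F⊆E)) (agree F⊆E)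

IsFlat : RawMatroid n → Subset n → Set
IsFlat M F = F ⊆ ground M × (∀ {x} → x ∈ ground M → x ∉ F → rk M F < rk M (F ∪ ⁅ x ⁆))

isFlatᵇ⇔IsFlat : (M : RawMatroid n) (F : Subset n) → T (isFlatᵇ M F) ⇔ IsFlat M F
isFlatᵇ⇔IsFlat {n} M F = mk⇔ elim intro
  where
  E = ground M
  step : ∀ x → T (not ((x ∈ᵇ E) ∧ not (x ∈ᵇ F)) ∨ (rk M F <ᵇ rk M (F ∪ ⁅ x ⁆))) ⇔
               (x ∈ E → x ∉ F → rk M F < rk M (F ∪ ⁅ x ⁆))
  step x with lookup E x in x∈ᵇE | lookup F x in x∈ᵇF
  ... | false | _     = mk⇔ (λ _ x∈E → contradiction (trans (sym ([]=⇒lookup x∈E)) x∈ᵇE) λ ()) _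
  ... | true  | true  = mk⇔ (λ _ _ x∉F → contradiction (lookup⇒[]= x F x∈ᵇF) x∉F) _
  ... | true  | false = mk⇔ (λ t _ _ → <ᵇ⇒< _ _ t)
    (λ grows → <⇒<ᵇ (grows (lookup⇒[]= x E x∈ᵇE)
                          (λ x∈F → contradiction (trans (sym ([]=⇒lookup x∈F)) x∈ᵇF) λ ())))
  elim : T (isFlatᵇ M F) → IsFlat M F
  elim t = to (⊆ᵇ⇔⊆ F E) (proj₁ parts) ,
           λ {x} → to (step x) (to (allᵇ⇔ _ (allFin n)) (proj₂ parts) (∈-allFin x))
    where parts = to (T-∧ {F ⊆ᵇ E}) t
  intro : IsFlat M F → T (isFlatᵇ M F)
  intro (F⊆E , grows) =
    from T-∧ (from (⊆ᵇ⇔⊆ F E) F⊆E , from (allᵇ⇔ _ (allFin n)) (λ {x} _ → from (step x) grows))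

flats-agree : {E : Subset n} {r r' : Subset n → ℕ} → Agree E r r' → flats (mk E r) ≡ flats (mk E r')
flats-agree {E = E} {r} {r'} agree =
  filter-≐ (T? ∘ isFlatᵇ (mk E r)) (T? ∘ isFlatᵇ (mk E r'))
    (transfer agree , transfer (Agree-sym agree)) (subsetsOf E)
  where
  transfer : ∀ {s s'} → Agree E s s' → ∀ {F} → T (isFlatᵇ (mk E s) F) → T (isFlatᵇ (mk E s') F)
  transfer {s} {s'} agree {F} t with F⊆E , grows ← to (isFlatᵇ⇔IsFlat (mk E s) F) t =
    from (isFlatᵇ⇔IsFlat (mk E s') F) (F⊆E , λ x∈E x∉F →
      subst₂ _<_ (agree F⊆E) (agree (∪-least F⊆E (λ y∈ → subst (_∈ E) (sym (x∈⁅y⁆⇒x≡y _ y∈)) x∈E)))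
        (grows x∈E x∉F))

flat⊆ground : (M : RawMatroid n) {F : Subset n} → F ∈ₗ flats M → F ⊆ ground M
flat⊆ground M F∈ = ∈-subsetsOf⁻ (proj₁ (∈-filterᵇ⁻ (isFlatᵇ M) F∈))

rank-contract : (M : RawMatroid n) {F : Subset n} → F ⊆ ground M → rank (contract M F) ≡ rank M ∸ rk M F
rank-contract M F⊆E = cong (λ A → rk M A ∸ rk M _) (p─q∪q≡p F⊆E)

isIndepᵇ-intro : (M : RawMatroid n) {B : Subset n} → B ⊆ ground M → rk M B ≡ ∣ B ∣ → T (isIndepᵇ M B)
isIndepᵇ-intro M {B} B⊆E rkB≡∣B∣ = from T-∧ (from (⊆ᵇ⇔⊆ B (ground M)) B⊆E , ≡⇒≡ᵇ _ _ rkB≡∣B∣)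

isCircuitᵇ-intro : (M : RawMatroid n) {C : Subset n} → C ⊆ ground M → rk M C ≢ ∣ C ∣ →
  (∀ {B} → B ⊆ C → B ≢ C → rk M B ≡ ∣ B ∣) → T (isCircuitᵇ M C)
isCircuitᵇ-intro M {C} C⊆E dependent minimal =
  from T-∧ (from (⊆ᵇ⇔⊆ C (ground M)) C⊆E ,
    from T-∧ (¬T⇒T-not (dependent ∘ ≡ᵇ⇒≡ _ _ ∘ proj₂ ∘ to (T-∧ {C ⊆ᵇ ground M})) ,
      from (allᵇ⇔ _ (subsetsOf C)) properSubset))
  where
  properSubset : ∀ {B} → B ∈ₗ subsetsOf C → T ((B ==ᵇ C) ∨ isIndepᵇ M B)
  properSubset {B} B∈ with B ≟ₛ C
  ... | yes refl = from T-∨ (inj₁ (==ᵇ-refl B))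
  ... | no  B≢C  = from T-∨ (inj₂ (isIndepᵇ-intro M (⊆-trans B⊆C C⊆E) (minimal B⊆C B≢C)))
    where B⊆C = ∈-subsetsOf⁻ B∈

isHyperplaneᵇ-intro : (M : RawMatroid n) {H : Subset n} → IsFlat M H → suc (rk M H) ≡ rank M →
  T (isHyperplaneᵇ M H)
isHyperplaneᵇ-intro M {H} flat rank≡ = from T-∧ (from (isFlatᵇ⇔IsFlat M H) flat , ≡⇒≡ᵇ _ _ rank≡)

isHyperplaneᵇ-rank : (M : RawMatroid n) {H : Subset n} → T (isHyperplaneᵇ M H) → suc (rk M H) ≡ rank M
isHyperplaneᵇ-rank M {H} t = ≡ᵇ⇒≡ _ _ (proj₂ (to (T-∧ {isFlatᵇ M H}) t))

sumℤ-zero : {X : Set} (f : X → ℤ) (xs : List X) → (∀ {x} → x ∈ₗ xs → f x ≡ + 0) → sumℤ (map f xs) ≡ + 0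
sumℤ-zero f []       _ = refl
sumℤ-zero f (x ∷ xs) h = cong₂ ℤ._+_ (h (here refl)) (sumℤ-zero f xs (h ∘ there))

sumₚ-zero-at : {X : Set} (f : X → Poly) (xs : List X) (i : ℕ) →
  (∀ {x} → x ∈ₗ xs → f x i ≡ + 0) → sumₚ (map f xs) i ≡ + 0
sumₚ-zero-at f []       i _ = refl
sumₚ-zero-at f (x ∷ xs) i h = cong₂ ℤ._+_ (h (here refl)) (sumₚ-zero-at f xs i (h ∘ there))

sumₚ-cong-at : {X : Set} (f g : X → Poly) (xs : List X) (i : ℕ) →
  (∀ {x} → x ∈ₗ xs → f x i ≡ g x i) → sumₚ (map f xs) i ≡ sumₚ (map g xs) i
sumₚ-cong-at f g []       i _ = refl
sumₚ-cong-at f g (x ∷ xs) i h = cong₂ ℤ._+_ (h (here refl)) (sumₚ-cong-at f g xs i (h ∘ there))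

*ₚ-cong : {a a' b b' : Poly} → a ≈ₚ a' → b ≈ₚ b' → a *ₚ b ≈ₚ a' *ₚ b'
*ₚ-cong a≈a' b≈b' i = cong sumℤ (map-cong (λ j → cong₂ ℤ._*_ (a≈a' j) (b≈b' (i ∸ j))) (upTo (suc i)))

rev-cong : ∀ d {a a' : Poly} → a ≈ₚ a' → rev d a ≈ₚ rev d a'
rev-cong d a≈a' i with i ℕ.≤ᵇ d
... | true  = a≈a' (d ∸ i)
... | false = refl

rev-at-∸ : ∀ R (p : Poly) {i} → i ≤ R → rev R p (R ∸ i) ≡ p i
rev-at-∸ R p {i} i≤R with (R ∸ i) ℕ.≤ᵇ R in R∸i≤ᵇR
... | true  = cong p (m∸[m∸n]≡n i≤R)
... | false = contradiction (subst T R∸i≤ᵇR (≤⇒≤ᵇ (m∸n≤m R i))) λ ()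

Constant : Poly → Set
Constant c = ∀ l → c (suc l) ≡ + 0

rev-zero-constant : (p : Poly) → Constant (rev 0 p)
rev-zero-constant p l = refl

*ₚ-zero-constantˡ : (c q : Poly) {j : ℕ} → Constant c → q j ≡ + 0 → (c *ₚ q) j ≡ + 0
*ₚ-zero-constantˡ c q {j} c-const qj≡0 = sumℤ-zero _ (upTo (suc j)) term
  where
  term : ∀ {l} → l ∈ₗ upTo (suc j) → c l ℤ.* q (j ∸ l) ≡ + 0
  term {zero}  _ = trans (cong (c 0 ℤ.*_) qj≡0) (ℤP.*-zeroʳ (c 0))
  term {suc l} _ = cong (ℤ._* q (j ∸ suc l)) (c-const l)

*ₚ-zero-constantʳ : (q c : Poly) {j : ℕ} → q j ≡ + 0 → Constant c → (q *ₚ c) j ≡ + 0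
*ₚ-zero-constantʳ q c {j} qj≡0 c-const = sumℤ-zero _ (upTo (suc j)) term
  where
  term : ∀ {l} → l ∈ₗ upTo (suc j) → q l ℤ.* c (j ∸ l) ≡ + 0
  term {l} l∈ with j ∸ l in j∸l≡
  ... | suc m = trans (cong (q l ℤ.*_) (c-const m)) (ℤP.*-zeroʳ (q l))
  ... | zero  = trans (cong (λ l → q l ℤ.* c 0) l≡j) (cong (ℤ._* c 0) qj≡0)
    where l≡j = ≤-antisym (≤-pred (∈-upTo⁻ l∈)) (m∸n≡0⇒m≤n j∸l≡)

sign-involutive : ∀ m x → sign m ℤ.* (sign m ℤ.* x) ≡ x
sign-involutive zero    x = trans (ℤP.*-identityˡ _) (ℤP.*-identityˡ x)
sign-involutive (suc m) x = trans (neg-twice (sign m) x) (sign-involutive m x)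
  where
  neg-twice : ∀ s x → ℤ.- s ℤ.* (ℤ.- s ℤ.* x) ≡ s ℤ.* (s ℤ.* x)
  neg-twice = solve-∀

sign-cancel : ∀ m {x y} → sign m ℤ.* x ≡ sign m ℤ.* y → x ≡ y
sign-cancel m {x} {y} eq =
  trans (sym (sign-involutive m x)) (trans (cong (sign m ℤ.*_) eq) (sign-involutive m y))

χ-agree : {E : Subset n} {r r' : Subset n → ℕ} → Agree E r r' → χ (mk E r) ≈ₚ χ (mk E r')
χ-agree {E = E} agree i = sumₚ-cong-at _ _ (subsetsOf E) i λ {A} A∈ →
  cong (λ d → sign ∣ A ∣ ℤ.* mono d i) (cong₂ _∸_ (agree ⊆-refl) (agree (∈-subsetsOf⁻ A∈)))

χ-rank-zero-constant : {F : Subset n} (r : Subset n → ℕ) → r F ≡ 0 → Constant (χ (mk F r))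
χ-rank-zero-constant {F = F} r rF≡0 l = sumₚ-zero-at _ (subsetsOf F) (suc l) λ {A} _ →
  trans (cong (λ d → sign ∣ A ∣ ℤ.* mono (d ∸ r A) (suc l)) rF≡0)
        (trans (cong (λ d → sign ∣ A ∣ ℤ.* mono d (suc l)) (0∸n≡0 (r A))) (ℤP.*-zeroʳ (sign ∣ A ∣)))

2i≤m⇒m≤2[m∸i] : ∀ {i m} → 2 ℕ.* i ≤ m → m ≤ 2 ℕ.* (m ∸ i)
2i≤m⇒m≤2[m∸i] {i} {m} 2i≤m = begin
  m                 ≡⟨ sym (m∸n+n≡m i≤m) ⟩
  m ∸ i + i         ≤⟨ +-monoʳ-≤ (m ∸ i) (m+n≤o⇒m≤o∸n i i+i≤m) ⟩
  m ∸ i + (m ∸ i)   ≡⟨ cong (_+_ (m ∸ i)) (sym (+-identityʳ (m ∸ i))) ⟩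
  2 ℕ.* (m ∸ i)     ∎
  where
  open ≤-Reasoning
  i+i≤m = subst (_≤ m) (cong (_+_ i) (+-identityʳ i)) 2i≤m
  i≤m = m+n≤o⇒m≤o i i+i≤m

rev-agree-at : {R R' : ℕ} {p p' : Poly} {i : ℕ} → R ≡ R' → i ≤ R →
  rev R p (R ∸ i) ≡ rev R' p' (R ∸ i) → p i ≡ p' i
rev-agree-at {R} {p = p} {p'} refl i≤R eq = trans (sym (rev-at-∸ R p i≤R)) (trans eq (rev-at-∸ R p' i≤R))

-- P, Q and Z only see the rank function on the ground set

Normalised : Family → Set
Normalised Φ = ∀ {n} (M : RawMatroid n) → IsMatroid M →
  (rank M ≡ 0 → (ground M ≡ ⊥ → Φ M ≈ₚ 1ₚ) × (ground M ≢ ⊥ → Φ M ≈ₚ 0ₚ)) ×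
  (0 < rank M → DegLtHalf (rank M) (Φ M))

RankInvariant : Family → Set
RankInvariant Φ = ∀ {n} {E : Subset n} {r r' : Subset n → ℕ} →
  IsMatroid (mk E r) → IsMatroid (mk E r') → Agree E r r' → Φ (mk E r) ≈ₚ Φ (mk E r')

normalised-agree-high : {Φ : Family} → Normalised Φ → {E : Subset n} {r r' : Subset n → ℕ} →
  IsMatroid (mk E r) → IsMatroid (mk E r') → Agree E r r' →
  ∀ {i} → r E ≤ 2 ℕ.* i → Φ (mk E r) i ≡ Φ (mk E r') i
normalised-agree-high norm {E} {r} {r'} isM isM' agree {i} R≤2i with r E ℕ.≟ 0 | E ≟ₛ ⊥
... | yes R≡0 | yes E≡∅ = trans (proj₁ (proj₁ (norm _ isM) R≡0) E≡∅ i)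
                                (sym (proj₁ (proj₁ (norm _ isM') (trans (sym (agree ⊆-refl)) R≡0)) E≡∅ i))
... | yes R≡0 | no  E≢∅ = trans (proj₂ (proj₁ (norm _ isM) R≡0) E≢∅ i)
                                (sym (proj₂ (proj₁ (norm _ isM') (trans (sym (agree ⊆-refl)) R≡0)) E≢∅ i))
... | no  R≢0 | _       = trans (proj₂ (norm _ isM) (n≢0⇒n>0 R≢0) i R≤2i)
  (sym (proj₂ (norm _ isM') (subst (0 <_) (agree ⊆-refl) (n≢0⇒n>0 R≢0)) i (subst (_≤ 2 ℕ.* i) (agree ⊆-refl) R≤2i)))

2i<m⇒i≤m : ∀ {i m} → 2 ℕ.* i < m → i ≤ m
2i<m⇒i≤m {i} {m} 2i<m = m+n≤o⇒m≤o i (subst (_≤ m) (cong (_+_ i) (+-identityʳ i)) (<⇒≤ 2i<m))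

module _ {P : Family} (kl : IsKL P) where

  private
    normalised : Normalised P
    normalised M isM = proj₁ (kl M isM) , proj₁ (proj₂ (kl M isM))

  -- contracting a rank-0 flat keeps the full rank, and P of that rank vanishes from degree rank/2 on
  KL-term-vanishes : (M : RawMatroid n) {F : Subset n} {j : ℕ} → IsMatroid M → F ⊆ ground M →
    rk M F ≡ 0 → 0 < rank M → rank M ≤ 2 ℕ.* j → (χ (restrict M F) *ₚ P (contract M F)) j ≡ + 0
  KL-term-vanishes M {F} {j} isM F⊆E rF≡0 0<R R≤2j =
    *ₚ-zero-constantˡ (χ (restrict M F)) (P (contract M F)) (χ-rank-zero-constant (rk M) rF≡0)
      (proj₂ (normalised _ (contract-isMatroid isM F⊆E))
        (subst (0 <_) (sym rank≡R) 0<R) j (subst (_≤ 2 ℕ.* j) (sym rank≡R) R≤2j))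
    where rank≡R = trans (rank-contract M F⊆E) (cong (rank M ∸_) rF≡0)

  KL-agree-below : ∀ d {n} {E : Subset n} {r r' : Subset n → ℕ} → r E ≤ d →
    IsMatroid (mk E r) → IsMatroid (mk E r') → Agree E r r' → P (mk E r) ≈ₚ P (mk E r')
  KL-agree-below zero R≤0 isM isM' agree i =
    normalised-agree-high normalised isM isM' agree (≤-trans R≤0 z≤n)
  KL-agree-below (suc d) {n} {E} {r} {r'} R≤1+d isM isM' agree i with 2 ℕ.* i <? r E
  ... | no  2i≮R = normalised-agree-high normalised isM isM' agree (≮⇒≥ 2i≮R)
  ... | yes 2i<R = rev-agree-at {p = P M} {P M'} R≡R' (2i<m⇒i≤m 2i<R) (begin
      rev R (P M) j                      ≡⟨ proj₂ (proj₂ (kl M isM)) j ⟩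
      sumₚ (map (term M) (flats M)) j    ≡⟨ sumₚ-cong-at (term M) (term M') (flats M) j termwise ⟩
      sumₚ (map (term M') (flats M)) j   ≡⟨ cong (λ Fs → sumₚ (map (term M') Fs) j) (flats-agree agree) ⟩
      sumₚ (map (term M') (flats M')) j  ≡⟨ sym (proj₂ (proj₂ (kl M' isM')) j) ⟩
      rev (r' E) (P M') j                ∎)
    where
    open ≡-Reasoning
    M = mk E r
    M' = mk E r'
    R = r E
    R≡R' = agree ⊆-refl
    j = R ∸ i
    0<R = ≤-trans (s≤s z≤n) 2i<R
    R≤2j = 2i≤m⇒m≤2[m∸i] {i} (<⇒≤ 2i<R)
    term : RawMatroid n → Subset n → Poly
    term N F = χ (restrict N F) *ₚ P (contract N F)
    termwise : ∀ {F} → F ∈ₗ flats M → term M F j ≡ term M' F j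
    termwise {F} F∈ with r F ℕ.≟ 0
    ... | yes rF≡0 = trans (KL-term-vanishes M {j = j} isM F⊆E rF≡0 0<R R≤2j)
        (sym (KL-term-vanishes M' {j = j} isM' F⊆E (trans (sym (agree F⊆E)) rF≡0)
               (subst (0 <_) R≡R' 0<R) (subst (_≤ 2 ℕ.* j) R≡R' R≤2j)))
      where F⊆E = flat⊆ground M F∈
    ... | no rF≢0 = *ₚ-cong (χ-agree (Agree-restrict agree F⊆E))
        (KL-agree-below d rank≤d (contract-isMatroid isM F⊆E) (contract-isMatroid isM' F⊆E)
                        (Agree-contract agree F⊆E)) j
      where
      F⊆E = flat⊆ground M F∈
      rank≤d = subst (_≤ d) (sym (rank-contract M F⊆E))
        (≤-trans (∸-monoʳ-≤ {1} {r F} R (n≢0⇒n>0 rF≢0)) (∸-monoˡ-≤ 1 R≤1+d))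

  KL-rankInvariant : RankInvariant P
  KL-rankInvariant {E = E} {r} = KL-agree-below (r E) ≤-refl

module _ {Q : Family} (ikl : IsInvKL Q) where

  private
    normalised : Normalised Q
    normalised M isM = proj₁ (ikl M isM) , proj₁ (proj₂ (ikl M isM))

  -- a spanning flat carries Q of the full rank, which vanishes from degree rank/2 on
  invKL-term-vanishes : (M : RawMatroid n) {F : Subset n} {j : ℕ} → IsMatroid M → F ⊆ ground M →
    rk M F ≡ rank M → 0 < rank M → rank M ≤ 2 ℕ.* j →
    (sign (rk M F) ·ₚ (Q (restrict M F) *ₚ rev (rank M ∸ rk M F) (χ (contract M F)))) j ≡ + 0
  invKL-term-vanishes M {F} {j} isM F⊆E rF≡R 0<R R≤2j = trans
    (cong (sign (rk M F) ℤ.*_) (*ₚ-zero-constantʳ (Q (restrict M F)) (rev (rank M ∸ rk M F) (χ (contract M F)))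
      (proj₂ (normalised _ (restrict-isMatroid isM F⊆E))
        (subst (0 <_) (sym rF≡R) 0<R) j (subst (_≤ 2 ℕ.* j) (sym rF≡R) R≤2j))
      (subst (λ e → Constant (rev e (χ (contract M F))))
        (sym (trans (cong (rank M ∸_) rF≡R) (n∸n≡0 (rank M)))) (rev-zero-constant (χ (contract M F))))))
    (ℤP.*-zeroʳ (sign (rk M F)))

  invKL-agree-below : ∀ d {n} {E : Subset n} {r r' : Subset n → ℕ} → r E ≤ d →
    IsMatroid (mk E r) → IsMatroid (mk E r') → Agree E r r' → Q (mk E r) ≈ₚ Q (mk E r')
  invKL-agree-below zero R≤0 isM isM' agree i =
    normalised-agree-high normalised isM isM' agree (≤-trans R≤0 z≤n)
  invKL-agree-below (suc d) {n} {E} {r} {r'} R≤1+d isM isM' agree i with 2 ℕ.* i <? r E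
  ... | no  2i≮R = normalised-agree-high normalised isM isM' agree (≮⇒≥ 2i≮R)
  ... | yes 2i<R = rev-agree-at {p = Q M} {Q M'} R≡R' (2i<m⇒i≤m 2i<R) (sign-cancel R (begin
      sign R ℤ.* rev R (Q M) j            ≡⟨ proj₂ (proj₂ (ikl M isM)) j ⟩
      sumₚ (map (term M) (flats M)) j     ≡⟨ sumₚ-cong-at (term M) (term M') (flats M) j termwise ⟩
      sumₚ (map (term M') (flats M)) j    ≡⟨ cong (λ Fs → sumₚ (map (term M') Fs) j) (flats-agree agree) ⟩
      sumₚ (map (term M') (flats M')) j   ≡⟨ sym (proj₂ (proj₂ (ikl M' isM')) j) ⟩
      sign (r' E) ℤ.* rev (r' E) (Q M') j ≡⟨ cong (λ R' → sign R' ℤ.* rev (r' E) (Q M') j) (sym R≡R') ⟩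
      sign R ℤ.* rev (r' E) (Q M') j      ∎))
    where
    open ≡-Reasoning
    M = mk E r
    M' = mk E r'
    R = r E
    R≡R' = agree ⊆-refl
    j = R ∸ i
    0<R = ≤-trans (s≤s z≤n) 2i<R
    R≤2j = 2i≤m⇒m≤2[m∸i] {i} (<⇒≤ 2i<R)
    term : RawMatroid n → Subset n → Poly
    term N F = sign (rk N F) ·ₚ (Q (restrict N F) *ₚ rev (rank N ∸ rk N F) (χ (contract N F)))
    termwise : ∀ {F} → F ∈ₗ flats M → term M F j ≡ term M' F j
    termwise {F} F∈ with r F <? R
    ... | yes rF<R = trans
        (cong (sign (r F) ℤ.*_) (*ₚ-cong
          (invKL-agree-below d (≤-pred (≤-trans rF<R R≤1+d))
            (restrict-isMatroid isM F⊆E) (restrict-isMatroid isM' F⊆E) (Agree-restrict agree F⊆E))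
          (rev-cong (R ∸ r F) (χ-agree (Agree-contract agree F⊆E))) j))
        (cong₂ (λ s e → sign s ℤ.* (Q (restrict M' F) *ₚ rev e (χ (contract M' F))) j)
          (agree F⊆E) (cong₂ _∸_ R≡R' (agree F⊆E)))
      where F⊆E = flat⊆ground M F∈
    ... | no rF≮R = trans (invKL-term-vanishes M {j = j} isM F⊆E rF≡R 0<R R≤2j)
        (sym (invKL-term-vanishes M' {j = j} isM' F⊆E (trans (sym (agree F⊆E)) (trans rF≡R R≡R'))
               (subst (0 <_) R≡R' 0<R) (subst (_≤ 2 ℕ.* j) R≡R' R≤2j)))
      where
      F⊆E = flat⊆ground M F∈
      rF≡R = ≤-antisym (rk-mono isM ⊆-refl F⊆E) (≮⇒≥ rF≮R)

  invKL-rankInvariant : RankInvariant Q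
  invKL-rankInvariant {E = E} {r} = invKL-agree-below (r E) ≤-refl

Z-rankInvariant : {P : Family} → IsKL P → RankInvariant (Zpoly P)
Z-rankInvariant {P} kl {E = E} {r} {r'} isM isM' agree i = begin
  sumₚ (map (term r) (flats (mk E r))) i   ≡⟨ sumₚ-cong-at (term r) (term r') (flats (mk E r)) i termwise ⟩
  sumₚ (map (term r') (flats (mk E r))) i  ≡⟨ cong (λ Fs → sumₚ (map (term r') Fs) i) (flats-agree agree) ⟩
  sumₚ (map (term r') (flats (mk E r'))) i ∎
  where
  open ≡-Reasoning
  term : (Subset _ → ℕ) → Subset _ → Poly
  term s F = mono (s F) *ₚ P (contract (mk E s) F)
  termwise : ∀ {F} → F ∈ₗ flats (mk E r) → term r F i ≡ term r' F i
  termwise F∈ = *ₚ-cong (λ l → cong (λ d → mono d l) (agree F⊆E))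
    (KL-rankInvariant kl (contract-isMatroid isM F⊆E) (contract-isMatroid isM' F⊆E)
                         (Agree-contract agree F⊆E)) i
    where F⊆E = flat⊆ground (mk E r) F∈

-- The sparse paving matroid with prescribed circuit-hyperplanes

⊓-concave : ∀ k {u i a b} → u + i ≡ a + b → i ≤ a → i ≤ b → k ⊓ u + k ⊓ i ≤ k ⊓ a + k ⊓ b
⊓-concave k {u} {i} {a} {b} u+i≡a+b i≤a i≤b with k ≤? a | k ≤? b
... | yes k≤a | yes k≤b rewrite m≤n⇒m⊓n≡m k≤a | m≤n⇒m⊓n≡m k≤b =
  +-mono-≤ (m⊓n≤m k u) (m⊓n≤m k i)
... | yes k≤a | no  k≰b rewrite m≤n⇒m⊓n≡m k≤a | m≥n⇒m⊓n≡n (<⇒≤ (≰⇒> k≰b)) =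
  +-mono-≤ (m⊓n≤m k u) (≤-trans (m⊓n≤n k i) i≤b)
... | no  k≰a | yes k≤b rewrite m≥n⇒m⊓n≡n (<⇒≤ (≰⇒> k≰a)) | m≤n⇒m⊓n≡m k≤b =
  ≤-trans (+-mono-≤ (m⊓n≤m k u) (≤-trans (m⊓n≤n k i) i≤a)) (≤-reflexive (+-comm k a))
... | no  k≰a | no  k≰b rewrite m≥n⇒m⊓n≡n (<⇒≤ (≰⇒> k≰a)) | m≥n⇒m⊓n≡n (<⇒≤ (≰⇒> k≰b)) =
  ≤-trans (+-mono-≤ (m⊓n≤n k u) (m⊓n≤n k i)) (≤-reflexive u+i≡a+b)

-- Ranks are written suc r, so that hyperplanes have rank r without truncated subtraction.
record SparseFamily (r : ℕ) (S : List (Subset n)) : Set where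
  field
    size    : ∀ {H} → H ∈ₗ S → ∣ H ∣ ≡ suc r
    proper  : ∀ {H} → H ∈ₗ S → ∣ H ∣ < n
    apart   : ∀ {H H'} → H ∈ₗ S → H' ∈ₗ S → H ≢ H' → ∣ H ∩ H' ∣ < r
    unique  : Unique S

SparseFamily-tail : ∀ {r H} {S : List (Subset n)} → SparseFamily r (H ∷ S) → SparseFamily r S
SparseFamily-tail sf = record
  { size = size ∘ there ; proper = proper ∘ there
  ; apart = λ H∈ H'∈ → apart (there H∈) (there H'∈)
  ; unique = Unique-tail unique }
  where open SparseFamily sf

sparseRank : ℕ → List (Subset n) → Subset n → ℕ
sparseRank r S A with A ∈ₛ? S
... | yes _ = r
... | no  _ = suc r ⊓ ∣ A ∣

sparsePaving : ℕ → List (Subset n) → RawMatroid n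
sparsePaving r S = mk ⊤ (sparseRank r S)

module _ {r : ℕ} {S : List (Subset n)} (sf : SparseFamily r S) where

  open SparseFamily sf

  private
    ρ : Subset n → ℕ
    ρ = sparseRank r S

  sparseRank-∈ : ∀ {A} → A ∈ₗ S → ρ A ≡ r
  sparseRank-∈ {A} A∈S with A ∈ₛ? S
  ... | yes _    = refl
  ... | no  A∉S = contradiction A∈S A∉S

  sparseRank-∉ : ∀ {A} → A ∉ₗ S → ρ A ≡ suc r ⊓ ∣ A ∣
  sparseRank-∉ {A} A∉S with A ∈ₛ? S
  ... | yes A∈S = contradiction A∈S A∉S
  ... | no  _   = refl

  sparseRank≤1+r : ∀ A → ρ A ≤ suc r
  sparseRank≤1+r A with A ∈ₛ? S
  ... | yes _ = n≤1+n r
  ... | no  _ = m⊓n≤m (suc r) ∣ A ∣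

  sparseRank≤∣∣ : ∀ A → ρ A ≤ ∣ A ∣
  sparseRank≤∣∣ A with A ∈ₛ? S
  ... | yes A∈S = ≤-trans (n≤1+n r) (≤-reflexive (sym (size A∈S)))
  ... | no  _   = m⊓n≤n (suc r) ∣ A ∣

  sparseRank-small : ∀ {A} → ∣ A ∣ ≤ r → ρ A ≡ ∣ A ∣
  sparseRank-small {A} ∣A∣≤r with A ∈ₛ? S
  ... | yes A∈S = contradiction (subst (_≤ r) (size A∈S) ∣A∣≤r) (<⇒≱ ≤-refl)
  ... | no  _   = m≥n⇒m⊓n≡n (m≤n⇒m≤1+n ∣A∣≤r)

  sparseRank-mono : ∀ {A B} → A ⊆ B → ρ A ≤ ρ B
  sparseRank-mono {A} {B} A⊆B with B ∈ₛ? S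
  ... | no _ = ⊓-glb (sparseRank≤1+r A) (≤-trans (sparseRank≤∣∣ A) (p⊆q⇒∣p∣≤∣q∣ A⊆B))
  ... | yes B∈S with A ≟ₛ B
  ...   | yes refl = ≤-reflexive (sparseRank-∈ B∈S)
  ...   | no  A≢B  = ≤-trans (sparseRank≤∣∣ A)
                       (≤-pred (subst (∣ A ∣ <_) (size B∈S) (p⊆q∧p≢q⇒∣p∣<∣q∣ A⊆B A≢B)))

  private
    sparseRank-∪ : ∀ A B {y} → suc (ρ (A ∩ B)) ≤ y → ρ (A ∪ B) + ρ (A ∩ B) ≤ r + y
    sparseRank-∪ A B {y} 1+ρ∩≤y = begin
      ρ (A ∪ B) + ρ (A ∩ B)   ≤⟨ +-monoˡ-≤ (ρ (A ∩ B)) (sparseRank≤1+r (A ∪ B)) ⟩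
      suc r + ρ (A ∩ B)       ≡⟨ sym (+-suc r (ρ (A ∩ B))) ⟩
      r + suc (ρ (A ∩ B))     ≤⟨ +-monoʳ-≤ r 1+ρ∩≤y ⟩
      r + y                   ∎
      where open ≤-Reasoning

    submodular-∈∉ : ∀ {A B} → A ∈ₗ S → B ∉ₗ S → ρ (A ∪ B) + ρ (A ∩ B) ≤ r + suc r ⊓ ∣ B ∣
    submodular-∈∉ {A} {B} A∈S B∉S with B ⊆? A
    ... | yes B⊆A = subst₂ (λ X Y → ρ X + ρ Y ≤ r + suc r ⊓ ∣ B ∣)
        (sym (⊆-antisym (∪-least ⊆-refl B⊆A) (p⊆p∪q B)))
        (sym (⊆-antisym (p∩q⊆q A B) (λ x∈B → x∈p∩q⁺ (B⊆A x∈B , x∈B))))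
        (≤-reflexive (cong₂ _+_ (sparseRank-∈ A∈S) (sparseRank-∉ B∉S)))
    ... | no  B⊈A = sparseRank-∪ A B (⊓-glb
        (s≤s (≤-trans (sparseRank-mono (p∩q⊆p A B)) (≤-reflexive (sparseRank-∈ A∈S))))
        (≤-<-trans (sparseRank≤∣∣ (A ∩ B))
          (p⊆q∧p≢q⇒∣p∣<∣q∣ (p∩q⊆q A B) (λ A∩B≡B → B⊈A (subst (_⊆ A) A∩B≡B (p∩q⊆p A B))))))

  sparseRank-submodular : ∀ A B → ρ (A ∪ B) + ρ (A ∩ B) ≤ ρ A + ρ B
  sparseRank-submodular A B with A ∈ₛ? S | B ∈ₛ? S
  ... | no  _   | no  _   = ≤-trans
        (+-mono-≤ (⊓-glb (sparseRank≤1+r (A ∪ B)) (sparseRank≤∣∣ (A ∪ B)))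
                  (⊓-glb (sparseRank≤1+r (A ∩ B)) (sparseRank≤∣∣ (A ∩ B))))
        (⊓-concave (suc r) (∣p∪q∣+∣p∩q∣≡∣p∣+∣q∣ A B) (∣p∩q∣≤∣p∣ A B) (∣p∩q∣≤∣q∣ A B))
  ... | yes A∈S | no  B∉S = submodular-∈∉ A∈S B∉S
  ... | no  A∉S | yes B∈S = subst₂ (λ X Y → ρ X + ρ Y ≤ suc r ⊓ ∣ A ∣ + r) (∪-comm B A) (∩-comm B A)
        (≤-trans (submodular-∈∉ B∈S A∉S) (≤-reflexive (+-comm r _)))
  ... | yes A∈S | yes B∈S with A ≟ₛ B
  ...   | yes refl rewrite ∪-idem A | ∩-idem A = ≤-reflexive (cong₂ _+_ (sparseRank-∈ A∈S) (sparseRank-∈ A∈S))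
  ...   | no  A≢B  = sparseRank-∪ A B (≤-trans (s≤s (sparseRank≤∣∣ (A ∩ B))) (apart A∈S B∈S A≢B))

  sparsePaving-isMatroid : IsMatroid (sparsePaving r S)
  sparsePaving-isMatroid =
    (λ A _ → sparseRank≤∣∣ A) , (λ A B _ → sparseRank-mono) , (λ A B _ _ → sparseRank-submodular A B)

  sparsePaving-rank : r < n → rank (sparsePaving r S) ≡ suc r
  sparsePaving-rank r<n = trans (sparseRank-∉ ⊤∉S) (m≤n⇒m⊓n≡m (subst (suc r ≤_) (sym (∣⊤∣≡n n)) r<n))
    where
    ⊤∉S : ⊤ ∉ₗ S
    ⊤∉S ⊤∈S = <-irrefl (∣⊤∣≡n n) (proper ⊤∈S)

  sparsePaving-circuitHyperplane : r < n → ∀ {H} → H ∈ₗ S → T (isCircuitHyperplaneᵇ (sparsePaving r S) H)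
  sparsePaving-circuitHyperplane r<n {H} H∈S = from T-∧ (circuit , hyperplane)
    where
    circuit = isCircuitᵇ-intro (sparsePaving r S) ⊆⊤
      (λ ρH≡∣H∣ → <-irrefl (trans (sym (sparseRank-∈ H∈S)) (trans ρH≡∣H∣ (size H∈S))) ≤-refl)
      (λ B⊆H B≢H → sparseRank-small (≤-pred (subst (_ <_) (size H∈S) (p⊆q∧p≢q⇒∣p∣<∣q∣ B⊆H B≢H))))
    grows : ∀ {x} → x ∈ ⊤ → x ∉ H → ρ H < ρ (H ∪ ⁅ x ⁆)
    grows {x} _ x∉H = subst₂ _<_ (sym (sparseRank-∈ H∈S)) (sym ρH∪x≡1+r) ≤-refl
      where
      ∣H∪x∣≡2+r = trans (∣p∪⁅x⁆∣≡1+∣p∣ H x∉H) (cong suc (size H∈S))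
      H∪x∉S : H ∪ ⁅ x ⁆ ∉ₗ S
      H∪x∉S H∪x∈S = <-irrefl (trans (sym (size H∪x∈S)) ∣H∪x∣≡2+r) ≤-refl
      ρH∪x≡1+r = trans (sparseRank-∉ H∪x∉S)
                       (m≤n⇒m⊓n≡m (subst (suc r ≤_) (sym ∣H∪x∣≡2+r) (n≤1+n (suc r))))
    hyperplane = isHyperplaneᵇ-intro (sparsePaving r S) (⊆⊤ , grows)
      (trans (cong suc (sparseRank-∈ H∈S)) (sym (sparsePaving-rank r<n)))

-- Relaxing a circuit-hyperplane

module _ {r : ℕ} {H : Subset n} {S : List (Subset n)} (sf : SparseFamily r (H ∷ S)) (r<n : r < n) where

  private
    sf' = SparseFamily-tail sf
    open SparseFamily sf' using (size; proper; apart)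
    N = sparsePaving r (H ∷ S)
    ρ' = sparseRank r S
    bases : List (Subset n)
    bases = filterᵇ (λ B → isBasisᵇ N B ∨ (B ==ᵇ H)) (subsetsOf ⊤)

  relaxation-bases⁻ : ∀ {B} → B ∈ₗ bases → ∣ B ∣ ≡ suc r × B ∉ₗ S
  relaxation-bases⁻ {B} B∈ with to (T-∨ {isBasisᵇ N B}) (proj₂ (∈-filterᵇ⁻ _ {xs = subsetsOf ⊤} B∈))
  ... | inj₁ basis = trans (sym ρB≡∣B∣) ρB≡1+r , λ B∈S →
        <-irrefl (trans (sym (sparseRank-∈ sf (there B∈S))) ρB≡1+r) ≤-refl
    where
    independent = to (T-∧ {isIndepᵇ N B}) basis
    ρB≡∣B∣ = ≡ᵇ⇒≡ _ _ (proj₂ (to (T-∧ {B ⊆ᵇ ⊤}) (proj₁ independent)))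
    ρB≡1+r = trans (≡ᵇ⇒≡ _ _ (proj₂ independent)) (sparsePaving-rank sf r<n)
  ... | inj₂ B==H with refl ← ==ᵇ⇒≡ B H B==H =
        SparseFamily.size sf (here refl) , Unique.Unique[x∷xs]⇒x∉xs (SparseFamily.unique sf)

  relaxation-bases⁺ : ∀ {B} → ∣ B ∣ ≡ suc r → B ∉ₗ S → B ∈ₗ bases
  relaxation-bases⁺ {B} ∣B∣≡1+r B∉S = ∈-filterᵇ⁺ _ (∈-subsetsOf⁺ ⊆⊤) (from T-∨ (basis-or-H (B ≟ₛ H)))
    where
    basis-or-H : Dec (B ≡ H) → T (isBasisᵇ N B) ⊎ T (B ==ᵇ H)
    basis-or-H (yes refl) = inj₂ (==ᵇ-refl B)
    basis-or-H (no B≢H)   = inj₁ (from T-∧ (isIndepᵇ-intro N {B} ⊆⊤ (trans ρB≡1+r (sym ∣B∣≡1+r)) ,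
                                             ≡⇒≡ᵇ _ _ (trans ρB≡1+r (sym (sparsePaving-rank sf r<n)))))
      where
      B∉H∷S : B ∉ₗ H ∷ S
      B∉H∷S (here B≡H)  = B≢H B≡H
      B∉H∷S (there B∈S) = B∉S B∈S
      ρB≡1+r = trans (sparseRank-∉ sf B∉H∷S) (trans (cong (suc r ⊓_) ∣B∣≡1+r) (⊓-idem (suc r)))

  -- it shares r elements with C, so apartness keeps it out of S
  exchange-basis : ∀ {C a x} → C ∈ₗ S → a ∈ C → x ∉ C → (C - a) ∪ ⁅ x ⁆ ∈ₗ bases
  exchange-basis {C} {a} {x} C∈S a∈C x∉C = relaxation-bases⁺ ∣B∣≡1+r B∉S
    where
    B = (C - a) ∪ ⁅ x ⁆
    1+∣C-a∣≡1+r = trans (1+∣p-x∣≡∣p∣ C a∈C) (size C∈S)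
    ∣B∣≡1+r = trans (∣p∪⁅x⁆∣≡1+∣p∣ (C - a) (x∉C ∘ p─q⊆p C ⁅ a ⁆)) 1+∣C-a∣≡1+r
    B∉S : B ∉ₗ S
    B∉S B∈S = <⇒≱ (apart B∈S C∈S (λ B≡C → x∉C (subst (x ∈_) B≡C (q⊆p∪q (C - a) ⁅ x ⁆ (x∈⁅x⁆ x)))))
      (subst (_≤ ∣ B ∩ C ∣) (suc-injective 1+∣C-a∣≡1+r) (∣r∣≤∣p∩q∣ (p⊆p∪q ⁅ x ⁆) (p─q⊆p C ⁅ a ⁆)))

  relaxation-upper : ∀ A {B} → B ∈ₗ bases → ∣ A ∩ B ∣ ≤ ρ' A
  relaxation-upper A {B} B∈ with A ∈ₛ? S | relaxation-bases⁻ B∈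
  ... | no  _   | ∣B∣≡1+r , _ = ⊓-glb (subst (∣ A ∩ B ∣ ≤_) ∣B∣≡1+r (∣p∩q∣≤∣q∣ A B)) (∣p∩q∣≤∣p∣ A B)
  ... | yes A∈S | ∣B∣≡1+r , B∉S = ≤-pred (≰⇒> λ 1+r≤∣A∩B∣ → B∉S (subst (_∈ₗ S) (A≡B 1+r≤∣A∩B∣) A∈S))
    where
    A≡B : suc r ≤ ∣ A ∩ B ∣ → A ≡ B
    A≡B 1+r≤ = trans (sym (p⊆q∧∣q∣≤∣p∣⇒p≡q (p∩q⊆p A B) (subst (_≤ ∣ A ∩ B ∣) (sym (size A∈S)) 1+r≤)))
                     (p⊆q∧∣q∣≤∣p∣⇒p≡q (p∩q⊆q A B) (subst (_≤ ∣ A ∩ B ∣) (sym ∣B∣≡1+r) 1+r≤))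

  basis-meeting-member : ∀ {A} → A ∈ₗ S → ∃ λ B → B ∈ₗ bases × r ≤ ∣ A ∩ B ∣
  basis-meeting-member {A} A∈S
    with a , a∈A ← ∃∈p A (subst (0 <_) (sym (size A∈S)) (s≤s z≤n))
       | x , x∉A ← ∃∉p A (proper A∈S)
    = _ , exchange-basis A∈S a∈A x∉A ,
      subst (_≤ _) (suc-injective (trans (1+∣p-x∣≡∣p∣ A a∈A) (size A∈S)))
        (∣r∣≤∣p∩q∣ (p─q⊆p A ⁅ a ⁆) (p⊆p∪q ⁅ x ⁆))

  basis-⊇ : ∀ {A} → A ∉ₗ S → ∣ A ∣ ≤ suc r → ∃ λ B → B ∈ₗ bases × A ⊆ B
  basis-⊇ {A} A∉S ∣A∣≤1+r with C , A⊆C , ∣C∣≡1+r ← ∃⊇-of-size A ∣A∣≤1+r r<n | C ∈ₛ? S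
  ... | no  C∉S = C , relaxation-bases⁺ ∣C∣≡1+r C∉S , A⊆C
  ... | yes C∈S
      with a , a∈C , a∉A ← ∃∈q∖p A⊆C (p⊆q∧p≢q⇒∣p∣<∣q∣ A⊆C (λ A≡C → A∉S (subst (_∈ₗ S) (sym A≡C) C∈S)))
         | x , x∉C ← ∃∉p C (proper C∈S)
      = _ , exchange-basis C∈S a∈C x∉C ,
        λ y∈A → p⊆p∪q ⁅ x ⁆ (x∈p∧x≢y⇒x∈p-y (A⊆C y∈A) (λ { refl → a∉A y∈A }))

  basis-⊆ : ∀ {A} → suc r < ∣ A ∣ → ∃ λ B → B ∈ₗ bases × B ⊆ A
  basis-⊆ {A} 1+r<∣A∣ with C , C⊆A , ∣C∣≡1+r ← ∃⊆-of-size A (<⇒≤ 1+r<∣A∣) | C ∈ₛ? S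
  ... | no  C∉S = C , relaxation-bases⁺ ∣C∣≡1+r C∉S , C⊆A
  ... | yes C∈S
      with x , x∈A , x∉C ← ∃∈q∖p C⊆A (subst (_< ∣ A ∣) (sym ∣C∣≡1+r) 1+r<∣A∣)
         | a , a∈C ← ∃∈p C (subst (0 <_) (sym ∣C∣≡1+r) (s≤s z≤n))
      = _ , exchange-basis C∈S a∈C x∉C ,
        ∪-least (⊆-trans (p─q⊆p C ⁅ a ⁆) C⊆A) (λ y∈ → subst (_∈ A) (sym (x∈⁅y⁆⇒x≡y x y∈)) x∈A)

  relaxation-lower : ∀ A → ∃ λ B → B ∈ₗ bases × ρ' A ≤ ∣ A ∩ B ∣
  relaxation-lower A with A ∈ₛ? S
  ... | yes A∈S = basis-meeting-member A∈S
  ... | no  A∉S with ∣ A ∣ ≤? suc r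
  ...   | yes ∣A∣≤1+r with B , B∈ , A⊆B ← basis-⊇ A∉S ∣A∣≤1+r =
          B , B∈ , ≤-trans (m⊓n≤n _ _) (∣r∣≤∣p∩q∣ ⊆-refl A⊆B)
  ...   | no  ∣A∣≰1+r with B , B∈ , B⊆A ← basis-⊆ {A} (≰⇒> ∣A∣≰1+r) =
          B , B∈ , ≤-trans (m⊓n≤m _ _)
                     (subst (_≤ ∣ A ∩ B ∣) (proj₁ (relaxation-bases⁻ B∈)) (∣r∣≤∣p∩q∣ B⊆A ⊆-refl))

  relax-sparsePaving-agree : Agree ⊤ (rk (relax N H)) ρ'
  relax-sparsePaving-agree {A} _ with B , B∈ , ρ'A≤ ← relaxation-lower A =
    ≤-antisym (maxℕ-lub _ upper) (≤-trans ρ'A≤ (≤-maxℕ (∈-map⁺ (λ B → ∣ A ∩ B ∣) B∈)))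
    where
    upper : ∀ {y} → y ∈ₗ map (λ B → ∣ A ∩ B ∣) bases → y ≤ ρ' A
    upper y∈ with B , B∈ , refl ← ∈-map⁻ (λ B → ∣ A ∩ B ∣) y∈ = relaxation-upper A B∈

-- A sparse paving matroid is determined by its circuit-hyperplanes

circuitHyperplanes : RawMatroid n → List (Subset n)
circuitHyperplanes M = filterᵇ (isCircuitHyperplaneᵇ M) (subsetsOf (ground M))

module _ {ρ : Subset n → ℕ} {r : ℕ} (isM : IsMatroid (mk ⊤ ρ)) (sparse : IsSparsePaving (mk ⊤ ρ))
         (ρ⊤≡1+r : ρ ⊤ ≡ suc r) where

  private
    M = mk ⊤ ρ
    paving = proj₁ sparse
    hyperplane≤ = proj₂ sparse

  rank≤n : r < n
  rank≤n = subst₂ _≤_ ρ⊤≡1+r (∣⊤∣≡n n) (rk≤∣∣ isM ⊆⊤)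

  private
    ρ≤1+r : ∀ A → ρ A ≤ suc r
    ρ≤1+r A = subst (ρ A ≤_) ρ⊤≡1+r (rk-mono isM ⊆⊤ ⊆⊤)

  -- a minimal dependent set of size ≤ r would be a circuit smaller than the rank
  paving-small-independent : ∀ {A} → ∣ A ∣ ≤ r → ρ A ≡ ∣ A ∣
  paving-small-independent {A} = go ∣ A ∣ ≤-refl
    where
    go : ∀ m {A} → ∣ A ∣ ≤ m → ∣ A ∣ ≤ r → ρ A ≡ ∣ A ∣
    go zero    {A} ∣A∣≤0 _ = trans (n≤0⇒n≡0 (≤-trans (rk≤∣∣ isM ⊆⊤) ∣A∣≤0)) (sym (n≤0⇒n≡0 ∣A∣≤0))
    go (suc m) {A} ∣A∣≤1+m ∣A∣≤r with ρ A ℕ.≟ ∣ A ∣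
    ... | yes ρA≡∣A∣ = ρA≡∣A∣
    ... | no  ρA≢∣A∣ = contradiction (subst (_≤ ∣ A ∣) ρ⊤≡1+r (paving A (isCircuitᵇ-intro M ⊆⊤ ρA≢∣A∣ proper)))
                                     (<⇒≱ (s≤s ∣A∣≤r))
      where
      proper : ∀ {B} → B ⊆ A → B ≢ A → ρ B ≡ ∣ B ∣
      proper B⊆A B≢A = go m (≤-pred (≤-trans ∣B∣<∣A∣ ∣A∣≤1+m)) (≤-trans (<⇒≤ ∣B∣<∣A∣) ∣A∣≤r)
        where ∣B∣<∣A∣ = p⊆q∧p≢q⇒∣p∣<∣q∣ B⊆A B≢A

  non-flat-extends : ∀ {A} → ¬ IsFlat M A → ∃ λ x → x ∉ A × ρ (A ∪ ⁅ x ⁆) ≡ ρ A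
  non-flat-extends {A} ¬flat
    with x , ¬grows ← ¬∀⟶∃¬ n _ (λ x → ¬? (x ∈? A) →-dec (ρ A <? ρ (A ∪ ⁅ x ⁆)))
                                (λ grows → ¬flat (⊆⊤ , λ {x} _ → grows x))
       | x ∈? A
  ... | yes x∈A = contradiction (λ x∉A → contradiction x∈A x∉A) ¬grows
  ... | no  x∉A = x , x∉A , ≤-antisym (≮⇒≥ (¬grows ∘ const)) (rk-mono isM ⊆⊤ (p⊆p∪q ⁅ x ⁆))

  closure : ∀ A → ∃ λ F → A ⊆ F × ρ F ≡ ρ A × IsFlat M F
  closure A = go n A (m≤m+n n ∣ A ∣)
    where
    go : ∀ fuel A → n ≤ fuel + ∣ A ∣ → ∃ λ F → A ⊆ F × ρ F ≡ ρ A × IsFlat M F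
    go fuel A n≤ with T? (isFlatᵇ M A)
    ... | yes flat = A , ⊆-refl , refl , to (isFlatᵇ⇔IsFlat M A) flat
    ... | no ¬flat with x , x∉A , ρA∪x≡ρA ← non-flat-extends (¬flat ∘ from (isFlatᵇ⇔IsFlat M A)) | fuel
    ...   | zero = contradiction (subst (x ∈_) (sym (∣p∣≡n⇒p≡⊤ (≤-antisym (∣p∣≤n A) n≤))) ∈⊤) x∉A
    ...   | suc fuel with F , A∪x⊆F , ρF≡ρA∪x , flat ← go fuel (A ∪ ⁅ x ⁆)
                       (subst (n ≤_) (trans (sym (+-suc fuel ∣ A ∣))
                                            (cong (_+_ fuel) (sym (∣p∪⁅x⁆∣≡1+∣p∣ A x∉A)))) n≤)
      = F , ⊆-trans (p⊆p∪q ⁅ x ⁆) A∪x⊆F , trans ρF≡ρA∪x ρA∪x≡ρA , flat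

  private
    hyperplane-of-rank : ∀ {F} → IsFlat M F → ρ F ≡ r → T (isHyperplaneᵇ M F)
    hyperplane-of-rank flat ρF≡r = isHyperplaneᵇ-intro M flat (trans (cong suc ρF≡r) (sym ρ⊤≡1+r))

    r≤ρ : ∀ {A} → suc r ≤ ∣ A ∣ → r ≤ ρ A
    r≤ρ {A} 1+r≤∣A∣ with C , C⊆A , ∣C∣≡r ← ∃⊆-of-size A (≤-trans (n≤1+n r) 1+r≤∣A∣) =
      subst (_≤ ρ A) (trans (paving-small-independent (≤-reflexive ∣C∣≡r)) ∣C∣≡r) (rk-mono isM ⊆⊤ C⊆A)

    not-full⇒ρ≡r : ∀ {A} → suc r ≤ ∣ A ∣ → ρ A ≢ suc r → ρ A ≡ r
    not-full⇒ρ≡r 1+r≤∣A∣ ρA≢1+r = ≤-antisym (≤-pred (≤∧≢⇒< (ρ≤1+r _) ρA≢1+r)) (r≤ρ 1+r≤∣A∣)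

  -- the closure of a non-spanning set of size > r + 1 would be a hyperplane of size > r + 1
  paving-large-spanning : ∀ {A} → suc r < ∣ A ∣ → ρ A ≡ suc r
  paving-large-spanning {A} 1+r<∣A∣ with ρ A ℕ.≟ suc r
  ... | yes ρA≡1+r = ρA≡1+r
  ... | no  ρA≢1+r with F , A⊆F , ρF≡ρA , flat ← closure A =
    contradiction (subst (∣ F ∣ ≤_) ρ⊤≡1+r (hyperplane≤ F (hyperplane-of-rank flat (trans ρF≡ρA ρA≡r))))
                  (<⇒≱ (<-≤-trans 1+r<∣A∣ (p⊆q⇒∣p∣≤∣q∣ A⊆F)))
    where ρA≡r = not-full⇒ρ≡r (<⇒≤ 1+r<∣A∣) ρA≢1+r

  circuitHyperplane⇒ : ∀ A → T (isCircuitHyperplaneᵇ M A) → ∣ A ∣ ≡ suc r × ρ A ≡ r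
  circuitHyperplane⇒ A t =
    ≤-antisym (subst (∣ A ∣ ≤_) ρ⊤≡1+r (hyperplane≤ A hyp)) (subst (_≤ ∣ A ∣) ρ⊤≡1+r (paving A circuit)) ,
    suc-injective (trans (isHyperplaneᵇ-rank M hyp) ρ⊤≡1+r)
    where
    circuit = proj₁ (to (T-∧ {isCircuitᵇ M A}) t)
    hyp = proj₂ (to (T-∧ {isCircuitᵇ M A}) t)

  circuitHyperplane⇐ : ∀ {A} → ∣ A ∣ ≡ suc r → ρ A ≡ r → T (isCircuitHyperplaneᵇ M A)
  circuitHyperplane⇐ {A} ∣A∣≡1+r ρA≡r with F , A⊆F , ρF≡ρA , flat ← closure A =
    from T-∧ (circuit , subst (T ∘ isHyperplaneᵇ M) (sym A≡F) hyp)
    where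
    circuit = isCircuitᵇ-intro M ⊆⊤ (λ ρA≡∣A∣ → <-irrefl (trans (sym ρA≡r) (trans ρA≡∣A∣ ∣A∣≡1+r)) ≤-refl)
      (λ B⊆A B≢A → paving-small-independent (≤-pred (subst (_ <_) ∣A∣≡1+r (p⊆q∧p≢q⇒∣p∣<∣q∣ B⊆A B≢A))))
    hyp = hyperplane-of-rank flat (trans ρF≡ρA ρA≡r)
    A≡F = p⊆q∧∣q∣≤∣p∣⇒p≡q A⊆F (subst (∣ F ∣ ≤_) (trans ρ⊤≡1+r (sym ∣A∣≡1+r)) (hyperplane≤ F hyp))

  private
    CH = circuitHyperplanes M

    ∈CH⇔ : ∀ A → A ∈ₗ CH ⇔ T (isCircuitHyperplaneᵇ M A)
    ∈CH⇔ A = mk⇔ (proj₂ ∘ ∈-filterᵇ⁻ (isCircuitHyperplaneᵇ M) {xs = subsetsOf ⊤})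
               (∈-filterᵇ⁺ (isCircuitHyperplaneᵇ M) (∈-subsetsOf⁺ ⊆⊤))

  circuitHyperplanes-sparse : SparseFamily r CH
  circuitHyperplanes-sparse = record
    { size = λ {H} H∈ → proj₁ (circuitHyperplane⇒ H (to (∈CH⇔ H) H∈))
    ; proper = λ {H} H∈ → ≤∧≢⇒< (∣p∣≤n H) (λ ∣H∣≡n → <-irrefl
        (trans (sym (proj₂ (circuitHyperplane⇒ H (to (∈CH⇔ H) H∈))))
               (trans (cong ρ (∣p∣≡n⇒p≡⊤ ∣H∣≡n)) ρ⊤≡1+r)) ≤-refl)
    ; apart = apart
    ; unique = Unique.filter⁺ (T? ∘ isCircuitHyperplaneᵇ M)
                 (Unique.filter⁺ (T? ∘ (_⊆ᵇ ⊤)) (allSubsets-unique n)) }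
    where
    apart : ∀ {H H'} → H ∈ₗ CH → H' ∈ₗ CH → H ≢ H' → ∣ H ∩ H' ∣ < r
    apart {H} {H'} H∈ H'∈ H≢H'
      with ∣H∣≡1+r , ρH≡r ← circuitHyperplane⇒ H (to (∈CH⇔ H) H∈)
         | ∣H'∣≡1+r , ρH'≡r ← circuitHyperplane⇒ H' (to (∈CH⇔ H') H'∈) = +-cancelˡ-≤ r (suc ∣ H ∩ H' ∣) r (begin
      r + suc ∣ H ∩ H' ∣          ≡⟨ +-suc r ∣ H ∩ H' ∣ ⟩
      suc r + ∣ H ∩ H' ∣          ≡⟨ sym (cong₂ _+_ (paving-large-spanning 1+r<∣H∪H'∣)
                                                    (paving-small-independent ∣H∩H'∣≤r)) ⟩
      ρ (H ∪ H') + ρ (H ∩ H')     ≤⟨ rk-submodular isM ⊆⊤ ⊆⊤ ⟩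
      ρ H + ρ H'                  ≡⟨ cong₂ _+_ ρH≡r ρH'≡r ⟩
      r + r                       ∎)
      where
      open ≤-Reasoning
      ∣H∩H'∣<1+r : ∣ H ∩ H' ∣ < suc r
      ∣H∩H'∣<1+r = ≰⇒> λ 1+r≤ → H≢H' (trans
        (sym (p⊆q∧∣q∣≤∣p∣⇒p≡q (p∩q⊆p H H') (subst (_≤ ∣ H ∩ H' ∣) (sym ∣H∣≡1+r) 1+r≤)))
        (p⊆q∧∣q∣≤∣p∣⇒p≡q (p∩q⊆q H H') (subst (_≤ ∣ H ∩ H' ∣) (sym ∣H'∣≡1+r) 1+r≤)))
      ∣H∩H'∣≤r = ≤-pred ∣H∩H'∣<1+r
      1+r<∣H∪H'∣ : suc r < ∣ H ∪ H' ∣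
      1+r<∣H∪H'∣ = +-cancelʳ-< (∣ H ∩ H' ∣) (suc r) (∣ H ∪ H' ∣)
        (subst (suc r + ∣ H ∩ H' ∣ <_) (sym (trans (∣p∪q∣+∣p∩q∣≡∣p∣+∣q∣ H H') (cong₂ _+_ ∣H∣≡1+r ∣H'∣≡1+r)))
          (+-monoʳ-< (suc r) ∣H∩H'∣<1+r))

  circuitHyperplanes-agree : Agree ⊤ ρ (sparseRank r CH)
  circuitHyperplanes-agree {A} _ with A ∈ₛ? CH
  ... | yes A∈CH = proj₂ (circuitHyperplane⇒ A (to (∈CH⇔ A) A∈CH))
  ... | no  A∉CH with <-cmp ∣ A ∣ (suc r)
  ...   | tri< ∣A∣<1+r _ _ = trans (paving-small-independent (≤-pred ∣A∣<1+r)) (sym (m≥n⇒m⊓n≡n (<⇒≤ ∣A∣<1+r)))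
  ...   | tri> _ _ 1+r<∣A∣ = trans (paving-large-spanning 1+r<∣A∣) (sym (m≤n⇒m⊓n≡m (<⇒≤ 1+r<∣A∣)))
  ...   | tri≈ _ ∣A∣≡1+r _ with ρ A ℕ.≟ suc r
  ...     | yes ρA≡1+r = trans ρA≡1+r (sym (m≤n⇒m⊓n≡m (≤-reflexive (sym ∣A∣≡1+r))))
  ...     | no  ρA≢1+r = contradiction (from (∈CH⇔ A) (circuitHyperplane⇐ ∣A∣≡1+r
                                          (not-full⇒ρ≡r (≤-reflexive (sym ∣A∣≡1+r)) ρA≢1+r))) A∉CH

-- Telescoping along the circuit-hyperplanes

module _ (Φ : Family) {c : Poly} {r : ℕ} (invariant : RankInvariant Φ)
         (relaxation : RelaxationDifference Φ (suc r) c) (r<n : r < n) where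

  relaxation-telescope : ∀ {S : List (Subset n)} → SparseFamily r S →
    Φ (sparsePaving r S) ≈ₚ Φ (uniform (suc r) n) -ₚ (+ length S) ·ₚ c
  -- sparsePaving r [] is definitionally uniform (suc r) n
  relaxation-telescope {[]}    _  i = x≡x-0*y (Φ (uniform (suc r) n) i) (c i)
    where
    x≡x-0*y : ∀ x y → x ≡ x ℤ.- + 0 ℤ.* y
    x≡x-0*y = solve-∀
  relaxation-telescope {H ∷ S} sf i = begin
    Φ N i                                   ≡⟨ x≡[x+y]-y (Φ N i) (c i) ⟩
    (Φ N i ℤ.+ c i) ℤ.- c i                 ≡⟨ cong (ℤ._- c i) (sym (relaxed i)) ⟩
    Φ (relax N H) i ℤ.- c i                 ≡⟨ cong (ℤ._- c i) (relaxed≈tail i) ⟩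
    Φ (sparsePaving r S) i ℤ.- c i          ≡⟨ cong (ℤ._- c i) (relaxation-telescope sf' i) ⟩
    (Φ U i ℤ.- (+ length S) ℤ.* c i) ℤ.- c i ≡⟨ [x-ly]-y≡x-[1+l]y (Φ U i) (+ length S) (c i) ⟩
    Φ U i ℤ.- (+ 1 ℤ.+ + length S) ℤ.* c i  ∎
    where
    open ≡-Reasoning
    N = sparsePaving r (H ∷ S)
    U = uniform (suc r) n
    sf' = SparseFamily-tail sf
    relaxed : Φ (relax N H) ≈ₚ Φ N +ₚ c
    relaxed = relaxation N (sparsePaving-isMatroid sf) (sparsePaving-rank sf r<n) H
                (sparsePaving-circuitHyperplane sf r<n (here refl))
    relaxed≈tail : Φ (relax N H) ≈ₚ Φ (sparsePaving r S)
    relaxed≈tail = invariant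
      (Agree-isMatroid (Agree-sym (relax-sparsePaving-agree sf r<n)) (sparsePaving-isMatroid sf'))
      (sparsePaving-isMatroid sf') (relax-sparsePaving-agree sf r<n)
    x≡[x+y]-y : ∀ x y → x ≡ (x ℤ.+ y) ℤ.- y
    x≡[x+y]-y = solve-∀
    [x-ly]-y≡x-[1+l]y : ∀ x l y → (x ℤ.- l ℤ.* y) ℤ.- y ≡ x ℤ.- (+ 1 ℤ.+ l) ℤ.* y
    [x-ly]-y≡x-[1+l]y = solve-∀

sparsePaving-relaxation-formula : (Φ : Family) {c : Poly} {r : ℕ} {ρ : Subset n → ℕ} →
  RankInvariant Φ → RelaxationDifference Φ (suc r) c →
  IsMatroid (mk ⊤ ρ) → IsSparsePaving (mk ⊤ ρ) → ρ ⊤ ≡ suc r →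
  Φ (mk ⊤ ρ) ≈ₚ Φ (uniform (suc r) n) -ₚ (+ numCircuitHyperplanes (mk ⊤ ρ)) ·ₚ c
sparsePaving-relaxation-formula Φ invariant relaxation isM sparse ρ⊤≡1+r i = trans
  (invariant isM (sparsePaving-isMatroid sf) (circuitHyperplanes-agree isM sparse ρ⊤≡1+r) i)
  (relaxation-telescope Φ invariant relaxation (rank≤n isM sparse ρ⊤≡1+r) sf i)
  where sf = circuitHyperplanes-sparse isM sparse ρ⊤≡1+r

theorem5p2 : (P Q : Family) → IsKL P → IsInvKL Q →
    (n k lam : ℕ) (M : RawMatroid n) → IsMatroid M → ground M ≡ ⊤ →
    IsSparsePaving M → rank M ≡ k → 1 ≤ k → numCircuitHyperplanes M ≡ lam →
    (p q z : Poly) →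
    RelaxationDifference P k p → RelaxationDifference Q k q →
    RelaxationDifference (Zpoly P) k z →
    (P M ≈ₚ P (uniform k n) -ₚ (+ lam) ·ₚ p) ×
    (Q M ≈ₚ Q (uniform k n) -ₚ (+ lam) ·ₚ q) ×
    (Zpoly P M ≈ₚ Zpoly P (uniform k n) -ₚ (+ lam) ·ₚ z)
theorem5p2 P Q kl ikl n (suc r) ._ M isM refl sparse rank≡1+r (s≤s z≤n) refl p q z relaxP relaxQ relaxZ =
  sparsePaving-relaxation-formula P (KL-rankInvariant kl) relaxP isM sparse rank≡1+r ,
  sparsePaving-relaxation-formula Q (invKL-rankInvariant ikl) relaxQ isM sparse rank≡1+r ,
  sparsePaving-relaxation-formula (Zpoly P) (Z-rankInvariant kl) relaxZ isM sparse rank≡1+r
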